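{- Let $g_1=1$ and $g_m=\sum_{k=1}^{m-1}\binom{m-1}{k-1}g_k$ for $m\ge2$, and for $n\ge2$ let $f_n=\sum_{k=0}^{n-2}\binom{n-2}{k}(k+1)\,g_{k+1}$. Then there is a constant $C$, numerically $C\approx 1.38$, such that $f_n/g_n\to C$ as $n\to\infty$.
   Context: The numbers $g_m$ are the shifted ordered Bell (Fubini) numbers: $g_{m}$ equals the number of ordered set partitions of an $(m-1)$-element set. -}

module Defs where

open import Data.Nat using (ℕ; zero; suc; _+_; _*_)
open import Data.Nat.Combinatorics using (_C_)
open import Data.List using (List; []; _∷_; length; map; upTo)
open import Data.Nat.ListAction using (sum)
open import Data.Integer using (+_)
open import Data.Rational using (ℚ; 0ℚ; _/_)

-- Weighted sum: for a list x ∷ xs, the element x sits at index j = length xs,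
-- and contributes  N C j * x.
wsum : ℕ → List ℕ → ℕ
wsum N []       = 0
wsum N (x ∷ xs) = (N C length xs) * x + wsum N xs

-- Rev m = [ G m , G (m-1) , … , G 0 ]   where  G k = g_(k+1).
-- G 0 = g_1 = 1 ;  G (m+1) = g_(m+2) = Σ_{k=1}^{m+1} C(m+1,k-1) g_k
--                          = Σ_{j=0}^{m} C(m+1,j) G j.
Rev : ℕ → List ℕ
Rev zero    = 1 ∷ []
Rev (suc m) = wsum (suc m) (Rev m) ∷ Rev m

headOr0 : List ℕ → ℕ
headOr0 []      = 0
headOr0 (x ∷ _) = x

-- g n  = g_n  for n ≥ 1 (the paper's sequence); g 0 = 0 is an unused junk value.
g : ℕ → ℕ
g zero    = 0
g (suc m) = headOr0 (Rev m)

-- f n = f_n = Σ_{k=0}^{n-2} C(n-2,k) (k+1) g_(k+1)  for n ≥ 2; junk 0 for n < 2.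
f : ℕ → ℕ
f (suc (suc m)) = sum (map (λ k → (m C k) * (suc k) * g (suc k)) (upTo (suc m)))
f _             = 0

-- ratio n = f_n / g_n as a rational (0 if g n = 0, which never happens for n ≥ 1).
ratio : ℕ → ℚ
ratio n with g n
... | zero  = 0ℚ
... | suc d = (+ f n) / suc d

module Submission where

-- Write a_m = g_(m+1), so a_0 = 1 and a_(m+1) = Σ_{j≤m} C(m+1,j) a_j, and put
-- c_m = a_m / m!,  σ_m = c_m / c_(m+1) = (m+1) a_m / a_(m+1).
--  * OrderedBell:   Pascal's rule and absorption for the binomial transform give
--                   f_(p+4) = 2(p+3) a_(p+2) − 2(p+2) a_(p+1).
--  * RatioBounds:   1/σ_n = Σ_{j≤n} (c_j/c_n)/(n+1−j)!  yields  1/2 ≤ σ_n ≤ 1  and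
--                   σ_(n+1) ≤ 4/5.
--  * Contraction:   by strong induction  |σ_(n+1) − σ_n| ≤ (9/10)^n,  comparing the
--                   sums for 1/σ_n and 1/σ_(n+1) term by term.
--  * Convergence:   f_(p+4)/g_(p+4) = 2σ_(p+2) − 2y_p  with  0 ≤ y_p ≤ 1/(p+3),  so the
--                   ratio is Cauchy with modulus 362/(N+1); an exact evaluation of
--                   σ_132 from a_132, a_133 and the tail bound (σ → log 2) place it
--                   within 1/100 of 1.38 from n = 134 on.

module Summation where

  open import Algebra.Bundles using (CommutativeSemiring)
  open import Data.Nat as ℕ using (ℕ; zero; suc)
  import Data.Nat.Properties as ℕP

  -- Finite sums  ∑ n F = F (n-1) + … + F 0  over a commutative semiring,
  -- indexed by ℕ (the library's sums are indexed by Fin, which would force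
  -- index conversions into every binomial coefficient and factorial below).
  module FiniteSums {c ℓ} (R : CommutativeSemiring c ℓ) where

    open CommutativeSemiring R
    open import Relation.Binary.Reasoning.Setoid setoid
    open import Algebra.Properties.CommutativeSemigroup +-commutativeSemigroup
      using (interchange; x∙yz≈y∙xz)

    ∑ : ℕ → (ℕ → Carrier) → Carrier
    ∑ zero    F = 0#
    ∑ (suc n) F = F n + ∑ n F

    ∑-cong : ∀ n {F G : ℕ → Carrier} → (∀ j → j ℕ.< n → F j ≈ G j) → ∑ n F ≈ ∑ n G
    ∑-cong zero    eq = refl
    ∑-cong (suc n) eq = +-cong (eq n ℕP.≤-refl) (∑-cong n (λ j j<n → eq j (ℕP.m<n⇒m<1+n j<n)))

    ∑-shift : ∀ n (F : ℕ → Carrier) → ∑ (suc n) F ≈ F 0 + ∑ n (λ j → F (suc j))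
    ∑-shift zero    F = refl
    ∑-shift (suc n) F = begin
      F (suc n) + ∑ (suc n) F                   ≈⟨ +-congˡ (∑-shift n F) ⟩
      F (suc n) + (F 0 + ∑ n (λ j → F (suc j))) ≈⟨ x∙yz≈y∙xz (F (suc n)) (F 0) _ ⟩
      F 0 + (F (suc n) + ∑ n (λ j → F (suc j))) ∎

    ∑-+ : ∀ n (F G : ℕ → Carrier) → ∑ n (λ j → F j + G j) ≈ ∑ n F + ∑ n G
    ∑-+ zero    F G = sym (+-identityˡ 0#)
    ∑-+ (suc n) F G = trans (+-congˡ (∑-+ n F G)) (interchange (F n) (G n) (∑ n F) (∑ n G))

    ∑-*ˡ : ∀ n k (F : ℕ → Carrier) → ∑ n (λ j → k * F j) ≈ k * ∑ n F
    ∑-*ˡ zero    k F = sym (zeroʳ k)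
    ∑-*ˡ (suc n) k F = trans (+-congˡ (∑-*ˡ n k F)) (sym (distribˡ k (F n) (∑ n F)))

    ∑-*ʳ : ∀ n (F : ℕ → Carrier) k → ∑ n (λ j → F j * k) ≈ ∑ n F * k
    ∑-*ʳ zero    F k = sym (zeroˡ k)
    ∑-*ʳ (suc n) F k = trans (+-congˡ (∑-*ʳ n F k)) (sym (distribʳ k (F n) (∑ n F)))

  module ℕSums = FiniteSums ℕP.+-*-commutativeSemiring

-- The ordered Bell numbers and the recurrence for f.
module OrderedBell where

  open Summation

  open import Defs using (g; f; Rev; wsum; headOr0)
  open import Data.Nat
  open import Data.Nat.Properties
  open import Data.Nat.Combinatorics
  open import Data.List using (List; []; _∷_; length; map; applyUpTo)
  open import Data.Nat.ListAction using (sum)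
  open import Function using (_∘_)
  open import Relation.Binary.PropositionalEquality
  open ℕSums

  B : (ℕ → ℕ) → ℕ → ℕ
  B u p = ∑ (suc p) (λ j → (p C j) * u j)

  pascal : ∀ u p → B u (suc p) ≡ B u p + B (u ∘ suc) p
  pascal u p = begin
    B u (suc p)
      ≡⟨ ∑-shift (suc p) (λ j → (suc p C j) * u j) ⟩
    1 * u 0 + ∑ (suc p) (λ j → (suc p C suc j) * u (suc j))
      ≡⟨ cong (1 * u 0 +_) (∑-cong (suc p) (λ j _ → split j)) ⟩
    1 * u 0 + ∑ (suc p) (λ j → (p C j) * u (suc j) + (p C suc j) * u (suc j))
      ≡⟨ cong (1 * u 0 +_) (∑-+ (suc p) (λ j → (p C j) * u (suc j)) (λ j → (p C suc j) * u (suc j))) ⟩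
    1 * u 0 + (B (u ∘ suc) p + X)
      ≡⟨ x∙yz≈y∙xz (1 * u 0) (B (u ∘ suc) p) X ⟩
    B (u ∘ suc) p + (1 * u 0 + X)
      ≡⟨ cong (B (u ∘ suc) p +_) (sym (∑-shift (suc p) (λ j → (p C j) * u j))) ⟩
    B (u ∘ suc) p + (((p C suc p) * u (suc p)) + B u p)
      ≡⟨ cong (λ z → B (u ∘ suc) p + (z * u (suc p) + B u p)) (k>n⇒nCk≡0 (n<1+n p)) ⟩
    B (u ∘ suc) p + B u p
      ≡⟨ +-comm (B (u ∘ suc) p) (B u p) ⟩
    B u p + B (u ∘ suc) p ∎
    where
    open ≡-Reasoning
    open import Algebra.Properties.CommutativeSemigroup +-commutativeSemigroup using (x∙yz≈y∙xz)
    X = ∑ (suc p) (λ j → (p C suc j) * u (suc j))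
    split : ∀ j → (suc p C suc j) * u (suc j) ≡ (p C j) * u (suc j) + (p C suc j) * u (suc j)
    split j = trans (cong (_* u (suc j)) (sym (nCk+nC[k+1]≡[n+1]C[k+1] p j)))
                    (*-distribʳ-+ (u (suc j)) (p C j) (p C suc j))

  absorption : ∀ p j → suc j * (suc p C suc j) ≡ suc p * (p C j)
  absorption zero    zero    = refl
  absorption zero    (suc j) = *-zeroʳ (suc (suc j))
  absorption (suc p) j = begin
    suc j * (suc (suc p) C suc j)
      ≡⟨ cong (suc j *_) (sym (nCk+nC[k+1]≡[n+1]C[k+1] (suc p) j)) ⟩
    suc j * (suc p C j + suc p C suc j)
      ≡⟨ *-distribˡ-+ (suc j) (suc p C j) (suc p C suc j) ⟩
    suc j * (suc p C j) + suc j * (suc p C suc j)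
      ≡⟨ cong (suc j * (suc p C j) +_) (absorption p j) ⟩
    suc j * (suc p C j) + suc p * (p C j)
      ≡⟨ lower j ⟩
    suc (suc p) * (suc p C j) ∎
    where
    open ≡-Reasoning
    lower : ∀ j → suc j * (suc p C j) + suc p * (p C j) ≡ suc (suc p) * (suc p C j)
    lower zero    = refl
    lower (suc i) = begin
      (suc p C suc i + suc i * (suc p C suc i)) + suc p * (p C suc i)
        ≡⟨ cong (λ z → (suc p C suc i + z) + suc p * (p C suc i)) (absorption p i) ⟩
      (suc p C suc i + suc p * (p C i)) + suc p * (p C suc i)
        ≡⟨ +-assoc (suc p C suc i) _ _ ⟩
      suc p C suc i + (suc p * (p C i) + suc p * (p C suc i))
        ≡⟨ cong (suc p C suc i +_) (sym (*-distribˡ-+ (suc p) (p C i) (p C suc i))) ⟩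
      suc p C suc i + suc p * (p C i + p C suc i)
        ≡⟨ cong (λ z → suc p C suc i + suc p * z) (nCk+nC[k+1]≡[n+1]C[k+1] p i) ⟩
      suc (suc p) * (suc p C suc i) ∎

  absorbed-sum : ∀ u p → ∑ (suc (suc p)) (λ k → (suc p C k) * (k * u k)) ≡ suc p * B (u ∘ suc) p
  absorbed-sum u p = begin
    ∑ (suc (suc p)) (λ k → (suc p C k) * (k * u k))
      ≡⟨ ∑-shift (suc p) (λ k → (suc p C k) * (k * u k)) ⟩
    (suc p C 0) * 0 + ∑ (suc p) (λ j → (suc p C suc j) * (suc j * u (suc j)))
      ≡⟨ cong ((suc p C 0) * 0 +_) (∑-cong (suc p) (λ j _ → term j)) ⟩
    0 + ∑ (suc p) (λ j → suc p * ((p C j) * u (suc j)))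
      ≡⟨ ∑-*ˡ (suc p) (suc p) (λ j → (p C j) * u (suc j)) ⟩
    suc p * B (u ∘ suc) p ∎
    where
    open ≡-Reasoning
    term : ∀ j → (suc p C suc j) * (suc j * u (suc j)) ≡ suc p * ((p C j) * u (suc j))
    term j = begin
      (suc p C suc j) * (suc j * u (suc j)) ≡⟨ sym (*-assoc (suc p C suc j) (suc j) _) ⟩
      (suc p C suc j) * suc j * u (suc j)   ≡⟨ cong (_* u (suc j)) (*-comm (suc p C suc j) (suc j)) ⟩
      suc j * (suc p C suc j) * u (suc j)   ≡⟨ cong (_* u (suc j)) (absorption p j) ⟩
      suc p * (p C j) * u (suc j)           ≡⟨ *-assoc (suc p) (p C j) _ ⟩
      suc p * ((p C j) * u (suc j))         ∎

  weighted-transform : ∀ u p →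
    ∑ (suc (suc p)) (λ k → (suc p C k) * (suc k * u k)) + suc p * B u p ≡ suc (suc p) * B u (suc p)
  weighted-transform u p = begin
    ∑ (suc (suc p)) (λ k → (suc p C k) * (suc k * u k)) + suc p * B u p
      ≡⟨ cong (_+ suc p * B u p) (∑-cong (suc (suc p)) (λ k _ → *-distribˡ-+ (suc p C k) (u k) (k * u k))) ⟩
    ∑ (suc (suc p)) (λ k → (suc p C k) * u k + (suc p C k) * (k * u k)) + suc p * B u p
      ≡⟨ cong (_+ suc p * B u p) (∑-+ (suc (suc p)) (λ k → (suc p C k) * u k) (λ k → (suc p C k) * (k * u k))) ⟩
    (B u (suc p) + ∑ (suc (suc p)) (λ k → (suc p C k) * (k * u k))) + suc p * B u p
      ≡⟨ cong (λ z → (B u (suc p) + z) + suc p * B u p) (absorbed-sum u p) ⟩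
    (B u (suc p) + suc p * B (u ∘ suc) p) + suc p * B u p
      ≡⟨ +-assoc (B u (suc p)) _ _ ⟩
    B u (suc p) + (suc p * B (u ∘ suc) p + suc p * B u p)
      ≡⟨ cong (B u (suc p) +_) (sym (*-distribˡ-+ (suc p) (B (u ∘ suc) p) (B u p))) ⟩
    B u (suc p) + suc p * (B (u ∘ suc) p + B u p)
      ≡⟨ cong (λ z → B u (suc p) + suc p * z) (trans (+-comm (B (u ∘ suc) p) (B u p)) (sym (pascal u p))) ⟩
    suc (suc p) * B u (suc p) ∎
    where open ≡-Reasoning

  -- Defs builds  Rev m = [g_(m+1), …, g_1]  by a clause mentioning  Rev m  twice,
  -- which evaluates in exponential time.  The same table, with the tail bound
  -- once by  extend  and hence shared, is what the numerical check evaluates.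
  table : ℕ → List ℕ
  table zero    = 1 ∷ []
  table (suc m) = extend (suc m) (table m)
    where
    extend : ℕ → List ℕ → List ℕ
    extend N xs = wsum N xs ∷ xs

  Rev≡table : ∀ m → Rev m ≡ table m
  Rev≡table zero    = refl
  Rev≡table (suc m) rewrite Rev≡table m = refl

  -- a m = g_(m+1) is the ordered Bell number of an m-element set.  It is opaque:
  -- its values are astronomically large, and the type checker must never try to
  -- evaluate them unless a numerical computation explicitly asks for it.
  opaque
    a : ℕ → ℕ
    a m = headOr0 (table m)

    g≡a : ∀ m → g (suc m) ≡ a m
    g≡a m = cong headOr0 (Rev≡table m)

    private
      length-table : ∀ m → length (table m) ≡ suc m
      length-table zero    = refl
      length-table (suc m) = cong suc (length-table m)

      wsum-table : ∀ N m → wsum N (table m) ≡ ∑ (suc m) (λ j → (N C j) * a j)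
      wsum-table N zero    = refl
      wsum-table N (suc m) rewrite length-table m | wsum-table N m = refl

    a-rec : ∀ m → a (suc m) ≡ ∑ (suc m) (λ j → (suc m C j) * a j)
    a-rec m = wsum-table (suc m) m

  B-a : ∀ m → B a (suc m) ≡ 2 * a (suc m)
  B-a m = begin
    (suc m C suc m) * a (suc m) + ∑ (suc m) (λ j → (suc m C j) * a j)
      ≡⟨ cong₂ _+_ (trans (cong (_* a (suc m)) (nCn≡1 (suc m))) (*-identityˡ (a (suc m)))) (sym (a-rec m)) ⟩
    a (suc m) + a (suc m)
      ≡⟨ cong (a (suc m) +_) (sym (+-identityʳ (a (suc m)))) ⟩
    2 * a (suc m) ∎
    where open ≡-Reasoning

  -- a_0 = 1 and a_(m+1) ≥ C(m+1,0) a_0 = 1.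
  a-pos : ∀ m → 1 ≤ a m
  a-pos zero    = ≤-reflexive (g≡a 0)
  a-pos (suc m) = begin
    1                                                           ≤⟨ a-pos 0 ⟩
    a 0                                                         ≡⟨ *-identityˡ (a 0) ⟨
    (suc m C 0) * a 0                                           ≤⟨ m≤m+n _ _ ⟩
    (suc m C 0) * a 0 + ∑ m (λ j → (suc m C suc j) * a (suc j)) ≡⟨ ∑-shift m (λ j → (suc m C j) * a j) ⟨
    ∑ (suc m) (λ j → (suc m C j) * a j)                         ≡⟨ a-rec m ⟨
    a (suc m)                                                   ∎
    where open ≤-Reasoning

  sum-applyUpTo : ∀ n (h k : ℕ → ℕ) → sum (map h (applyUpTo k n)) ≡ ∑ n (h ∘ k)
  sum-applyUpTo zero    h k = refl
  sum-applyUpTo (suc n) h k =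
    trans (cong (h (k 0) +_) (sum-applyUpTo n h (k ∘ suc))) (sym (∑-shift n (h ∘ k)))

  f-as-∑ : ∀ m → f (suc (suc m)) ≡ ∑ (suc m) (λ k → (m C k) * (suc k * a k))
  f-as-∑ m = trans (sum-applyUpTo (suc m) _ (λ k → k)) (∑-cong (suc m) (λ k _ → term k))
    where
    term : ∀ k → (m C k) * suc k * g (suc k) ≡ (m C k) * (suc k * a k)
    term k = trans (*-assoc (m C k) (suc k) (g (suc k))) (cong (λ z → (m C k) * (suc k * z)) (g≡a k))

  -- The key recurrence:  f_(r+4) = 2(r+3) a_(r+2) − 2(r+2) a_(r+1),  stated without subtraction.
  f-rec : ∀ r → f (4 + r) + (2 + r) * (2 * a (1 + r)) ≡ (3 + r) * (2 * a (2 + r))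
  f-rec r = begin
    f (4 + r) + (2 + r) * (2 * a (1 + r))
      ≡⟨ cong₂ (λ x y → x + (2 + r) * y) (f-as-∑ (2 + r)) (sym (B-a r)) ⟩
    ∑ (3 + r) (λ k → ((2 + r) C k) * (suc k * a k)) + (2 + r) * B a (1 + r)
      ≡⟨ weighted-transform a (1 + r) ⟩
    (3 + r) * B a (2 + r)
      ≡⟨ cong ((3 + r) *_) (B-a (1 + r)) ⟩
    (3 + r) * (2 * a (2 + r)) ∎
    where open ≡-Reasoning

-- The embedding ℕ → ℚ and elementary ordered-field facts.
module Rationals where

  open Summation
  open import Algebra.Bundles using (CommutativeRing)
  open import Data.Nat as ℕ using (ℕ; zero; suc)
  import Data.Nat.Properties as ℕP
  open import Data.Integer as ℤ using (+_)
  import Data.Integer.Properties as ℤP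
  open import Data.Rational
  open import Data.Rational.Properties
  import Data.Rational.Unnormalised as U
  import Data.Rational.Unnormalised.Properties as UP
  open import Data.Rational.Solver using (module +-*-Solver)
  open import Data.Product using (_×_; _,_)
  open import Data.Sum using (inj₁; inj₂)
  open import Relation.Binary.PropositionalEquality
  open +-*-Solver

  open import Algebra.Properties.Semiring.Exp (CommutativeRing.semiring +-*-commutativeRing) public
    using (_^_; ^-homo-*)

  -- The embedding ι : ℕ → ℚ, a semiring homomorphism.  It is opaque so that
  -- normalisation never unfolds the gcd computation hidden in  + n / 1.
  opaque
    ι : ℕ → ℚ
    ι n = + n / 1

    ι-def : ∀ n → ι n ≡ + n / 1
    ι-def n = refl

    ι-0 : ι 0 ≡ 0ℚ
    ι-0 = refl

    ι-1 : ι 1 ≡ 1ℚ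
    ι-1 = refl

    private
      toℚᵘ-ι : ∀ n → toℚᵘ (ι n) U.≃ U.mkℚᵘ (+ n) 0
      toℚᵘ-ι n = toℚᵘ-fromℚᵘ (U.mkℚᵘ (+ n) 0)

    ι-+ : ∀ m n → ι (m ℕ.+ n) ≡ ι m + ι n
    ι-+ m n = toℚᵘ-injective (begin
      toℚᵘ (ι (m ℕ.+ n))                       ≈⟨ toℚᵘ-ι (m ℕ.+ n) ⟩
      U.mkℚᵘ (+ (m ℕ.+ n)) 0                   ≈⟨ U.*≡* (cong (ℤ._* + 1) (trans (ℤP.pos-+ m n)
                                                    (sym (cong₂ ℤ._+_ (ℤP.*-identityʳ (+ m)) (ℤP.*-identityʳ (+ n)))))) ⟩
      U.mkℚᵘ (+ m) 0 U.+ U.mkℚᵘ (+ n) 0        ≈⟨ UP.+-cong (toℚᵘ-ι m) (toℚᵘ-ι n) ⟨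
      toℚᵘ (ι m) U.+ toℚᵘ (ι n)                ≈⟨ toℚᵘ-homo-+ (ι m) (ι n) ⟨
      toℚᵘ (ι m + ι n)                         ∎)
      where open UP.≃-Reasoning

    ι-* : ∀ m n → ι (m ℕ.* n) ≡ ι m * ι n
    ι-* m n = toℚᵘ-injective (begin
      toℚᵘ (ι (m ℕ.* n))                       ≈⟨ toℚᵘ-ι (m ℕ.* n) ⟩
      U.mkℚᵘ (+ (m ℕ.* n)) 0                   ≈⟨ U.*≡* (cong (ℤ._* + 1) (ℤP.pos-* m n)) ⟩
      U.mkℚᵘ (+ m) 0 U.* U.mkℚᵘ (+ n) 0        ≈⟨ UP.*-cong (toℚᵘ-ι m) (toℚᵘ-ι n) ⟨
      toℚᵘ (ι m) U.* toℚᵘ (ι n)                ≈⟨ toℚᵘ-homo-* (ι m) (ι n) ⟨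
      toℚᵘ (ι m * ι n)                         ∎)
      where open UP.≃-Reasoning

    frac-ι-mul : ∀ m d → ((+ m) / suc d) * ι (suc d) ≡ ι m
    frac-ι-mul m d = toℚᵘ-injective (begin
      toℚᵘ (((+ m) / suc d) * ι (suc d))               ≈⟨ toℚᵘ-homo-* ((+ m) / suc d) (ι (suc d)) ⟩
      toℚᵘ ((+ m) / suc d) U.* toℚᵘ (ι (suc d))        ≈⟨ UP.*-cong (toℚᵘ-fromℚᵘ (U.mkℚᵘ (+ m) d)) (toℚᵘ-ι (suc d)) ⟩
      U.mkℚᵘ (+ m) d U.* U.mkℚᵘ (+ suc d) 0            ≈⟨ U.*≡* (trans (ℤP.*-identityʳ _)
                                                            (cong (λ z → + m ℤ.* + z) (sym (cong suc (ℕP.*-identityʳ d))))) ⟩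
      U.mkℚᵘ (+ m) 0                                   ≈⟨ toℚᵘ-ι m ⟨
      toℚᵘ (ι m)                                       ∎)
      where open UP.≃-Reasoning

    ι-nonNeg : ∀ n → 0ℚ ≤ ι n
    ι-nonNeg n = nonNegative⁻¹ (ι n) {{normalize-nonNeg n 1}}

    ι-pos : ∀ n .{{_ : ℕ.NonZero n}} → 0ℚ < ι n
    ι-pos n = positive⁻¹ (ι n) {{normalize-pos n 1}}

  pos⇒nz : ∀ {x} → 0ℚ < x → NonZero x
  pos⇒nz {x} 0<x = pos⇒nonZero x {{positive 0<x}}

  instance
    ι-suc-nonZero : ∀ {n} → NonZero (ι (suc n))
    ι-suc-nonZero {n} = pos⇒nz (ι-pos (suc n))

  p≤p+q : ∀ p {q} → 0ℚ ≤ q → p ≤ p + q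
  p≤p+q p {q} 0≤q = subst (_≤ p + q) (+-identityʳ p) (+-monoʳ-≤ p 0≤q)

  ι-mono : ∀ {m n} → m ℕ.≤ n → ι m ≤ ι n
  ι-mono {m} {n} m≤n = subst (ι m ≤_) (trans (sym (ι-+ m (n ℕ.∸ m))) (cong ι (ℕP.m+[n∸m]≡n m≤n)))
                         (p≤p+q (ι m) (ι-nonNeg (n ℕ.∸ m)))

  ι-mono-< : ∀ {m n} → m ℕ.< n → ι m < ι n
  ι-mono-< {m} m<n = <-≤-trans m<1+m (ι-mono m<n)
    where
    m<1+m : ι m < ι (suc m)
    m<1+m = subst (ι m <_) (trans (+-comm (ι m) 1ℚ) (trans (cong (_+ ι m) (sym ι-1)) (sym (ι-+ 1 m))))
              (subst (_< ι m + 1ℚ) (+-identityʳ (ι m)) (+-monoʳ-< (ι m) (positive⁻¹ 1ℚ)))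

  frac-ι : ∀ m d → (+ m) / suc d ≡ ι m * 1/ ι (suc d)
  frac-ι m d = begin
    X                               ≡⟨ *-identityʳ X ⟨
    X * 1ℚ                          ≡⟨ cong (X *_) (*-inverseʳ (ι (suc d))) ⟨
    X * (ι (suc d) * 1/ ι (suc d))  ≡⟨ *-assoc X _ _ ⟨
    X * ι (suc d) * 1/ ι (suc d)    ≡⟨ cong (_* 1/ ι (suc d)) (frac-ι-mul m d) ⟩
    ι m * 1/ ι (suc d)              ∎
    where
    open ≡-Reasoning
    X = (+ m) / suc d

  *-monoˡ : ∀ {p q} r → 0ℚ ≤ r → p ≤ q → r * p ≤ r * q
  *-monoˡ r 0≤r p≤q = *-monoˡ-≤-nonNeg r {{nonNegative 0≤r}} p≤q

  *-monoʳ : ∀ {p q} r → 0ℚ ≤ r → p ≤ q → p * r ≤ q * r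
  *-monoʳ r 0≤r p≤q = *-monoʳ-≤-nonNeg r {{nonNegative 0≤r}} p≤q

  *-mono : ∀ {p q r s} → 0ℚ ≤ p → 0ℚ ≤ r → p ≤ q → r ≤ s → p * r ≤ q * s
  *-mono {p} {q} {r} {s} 0≤p 0≤r p≤q r≤s =
    ≤-trans (*-monoˡ p 0≤p r≤s) (*-monoʳ s (≤-trans 0≤r r≤s) p≤q)

  *-nonNeg : ∀ {p q} → 0ℚ ≤ p → 0ℚ ≤ q → 0ℚ ≤ p * q
  *-nonNeg {p} {q} 0≤p 0≤q = subst (_≤ p * q) (*-zeroˡ q) (*-monoʳ q 0≤q 0≤p)

  *-pos : ∀ {p q} → 0ℚ < p → 0ℚ < q → 0ℚ < p * q
  *-pos {p} {q} 0<p 0<q = positive⁻¹ (p * q) {{pos*pos⇒pos p {{positive 0<p}} q {{positive 0<q}}}}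

  1/-pos : ∀ x .{{_ : NonZero x}} → 0ℚ < x → 0ℚ < 1/ x
  1/-pos x 0<x = positive⁻¹ _ {{1/pos⇒pos x {{positive 0<x}}}}

  1/-nonNeg : ∀ x .{{_ : NonZero x}} → 0ℚ < x → 0ℚ ≤ 1/ x
  1/-nonNeg x 0<x = <⇒≤ (1/-pos x 0<x)

  1/-unique : ∀ x y .{{_ : NonZero x}} → x * y ≡ 1ℚ → 1/ x ≡ y
  1/-unique x y xy = begin
    1/ x             ≡⟨ *-identityʳ (1/ x) ⟨
    1/ x * 1ℚ        ≡⟨ cong (1/ x *_) xy ⟨
    1/ x * (x * y)   ≡⟨ *-assoc (1/ x) x y ⟨
    (1/ x * x) * y   ≡⟨ cong (_* y) (*-inverseˡ x) ⟩
    1ℚ * y           ≡⟨ *-identityˡ y ⟩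
    y                ∎
    where open ≡-Reasoning

  /-split : ∀ x p q r .{{_ : NonZero p}} .{{_ : NonZero q}} .{{_ : NonZero r}} →
            x * (p * q) ≡ r → x * 1/ r ≡ 1/ p * 1/ q
  /-split x p q r eq = begin
    x * 1/ r                               ≡⟨ trans (*-identityʳ _) (*-identityʳ _) ⟨
    x * 1/ r * 1ℚ * 1ℚ                     ≡⟨ cong₂ (λ u v → x * 1/ r * u * v) (*-inverseʳ p) (*-inverseʳ q) ⟨
    x * 1/ r * (p * 1/ p) * (q * 1/ q)     ≡⟨ solve 6 (λ x p q ip iq ir → x :* ir :* (p :* ip) :* (q :* iq) := x :* (p :* q) :* ir :* (ip :* iq)) refl x p q (1/ p) (1/ q) (1/ r) ⟩
    x * (p * q) * 1/ r * (1/ p * 1/ q)     ≡⟨ cong (λ z → z * 1/ r * (1/ p * 1/ q)) eq ⟩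
    r * 1/ r * (1/ p * 1/ q)               ≡⟨ cong (_* (1/ p * 1/ q)) (*-inverseʳ r) ⟩
    1ℚ * (1/ p * 1/ q)                     ≡⟨ *-identityˡ _ ⟩
    1/ p * 1/ q                            ∎
    where open ≡-Reasoning

  div-≤ : ∀ A B C .{{_ : NonZero B}} → 0ℚ < B → A ≤ C * B → A * 1/ B ≤ C
  div-≤ A B C 0<B h = begin
    A * 1/ B        ≤⟨ *-monoʳ (1/ B) (1/-nonNeg B 0<B) h ⟩
    C * B * 1/ B    ≡⟨ *-assoc C B (1/ B) ⟩
    C * (B * 1/ B)  ≡⟨ cong (C *_) (*-inverseʳ B) ⟩
    C * 1ℚ          ≡⟨ *-identityʳ C ⟩
    C               ∎
    where open ≤-Reasoning

  1/-≤ : ∀ p q .{{_ : NonZero p}} → 0ℚ < p → 1ℚ ≤ p * q → 1/ p ≤ q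
  1/-≤ p q 0<p h = subst (_≤ q) (*-identityˡ (1/ p))
    (div-≤ 1ℚ p q 0<p (subst (1ℚ ≤_) (*-comm p q) h))

  1/ι-antimono : ∀ {m n} → m ℕ.≤ n → 1/ ι (suc n) ≤ 1/ ι (suc m)
  1/ι-antimono {m} {n} m≤n = 1/-≤ (ι (suc n)) (1/ ι (suc m)) (ι-pos (suc n))
    (≤-trans (≤-reflexive (sym (*-inverseʳ (ι (suc m)))))
             (*-monoʳ (1/ ι (suc m)) (1/-nonNeg _ (ι-pos (suc m))) (ι-mono (ℕ.s≤s m≤n))))

  private
    cross-eq : ∀ x X Y .{{_ : NonZero X}} .{{_ : NonZero Y}} → x * 1/ X ≡ (x * Y) * (1/ X * 1/ Y)
    cross-eq x X Y = begin
      x * 1/ X                   ≡⟨ *-identityʳ (x * 1/ X) ⟨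
      x * 1/ X * 1ℚ              ≡⟨ cong (x * 1/ X *_) (*-inverseʳ Y) ⟨
      x * 1/ X * (Y * 1/ Y)      ≡⟨ solve 4 (λ x iX Y iY → x :* iX :* (Y :* iY) := (x :* Y) :* (iX :* iY)) refl x (1/ X) Y (1/ Y) ⟩
      (x * Y) * (1/ X * 1/ Y)    ∎
      where open ≡-Reasoning

    cross-eq′ : ∀ y X Y .{{_ : NonZero X}} .{{_ : NonZero Y}} → y * 1/ Y ≡ (y * X) * (1/ X * 1/ Y)
    cross-eq′ y X Y = trans (cross-eq y Y X) (cong ((y * X) *_) (*-comm (1/ Y) (1/ X)))

  ≤-cross : ∀ x y X Y .{{_ : NonZero X}} .{{_ : NonZero Y}} → 0ℚ < X → 0ℚ < Y →
            x * Y ≤ y * X → x * 1/ X ≤ y * 1/ Y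
  ≤-cross x y X Y 0<X 0<Y h = subst₂ _≤_ (sym (cross-eq x X Y)) (sym (cross-eq′ y X Y))
    (*-monoʳ (1/ X * 1/ Y) (<⇒≤ (*-pos (1/-pos X 0<X) (1/-pos Y 0<Y))) h)

  <-cross : ∀ x y X Y .{{_ : NonZero X}} .{{_ : NonZero Y}} → 0ℚ < X → 0ℚ < Y →
            x * Y < y * X → x * 1/ X < y * 1/ Y
  <-cross x y X Y 0<X 0<Y h = subst₂ _<_ (sym (cross-eq x X Y)) (sym (cross-eq′ y X Y))
    (*-monoˡ-<-pos (1/ X * 1/ Y) {{positive (*-pos (1/-pos X 0<X) (1/-pos Y 0<Y))}} h)

  ∣∣-≤ : ∀ {x y} → x ≤ y → - x ≤ y → ∣ x ∣ ≤ y
  ∣∣-≤ {x} {y} x≤y -x≤y with ∣p∣≡p∨∣p∣≡-p x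
  ... | inj₁ e = subst (_≤ y) (sym e) x≤y
  ... | inj₂ e = subst (_≤ y) (sym e) -x≤y

  ∣∣-≤⁻ : ∀ {x y} → ∣ x ∣ ≤ y → x ≤ y × - x ≤ y
  ∣∣-≤⁻ {x} {y} h = ≤-trans (x≤∣x∣ x) h , ≤-trans (x≤∣x∣ (- x)) (subst (_≤ y) (sym (∣-p∣≡∣p∣ x)) h)
    where
    x≤∣x∣ : ∀ x → x ≤ ∣ x ∣
    x≤∣x∣ x with ∣p∣≡p∨∣p∣≡-p x
    ... | inj₁ e = ≤-reflexive (sym e)
    ... | inj₂ e = ≤-trans (subst₂ _≤_ (solve 1 (λ x → :- (:- x) := x) refl x) refl
                             (neg-antimono-≤ (subst (0ℚ ≤_) e (0≤∣p∣ x))))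
                           (0≤∣p∣ x)

  ∣nonNeg*∣ : ∀ p q → 0ℚ ≤ p → ∣ p * q ∣ ≡ p * ∣ q ∣
  ∣nonNeg*∣ p q 0≤p = trans (∣p*q∣≡∣p∣*∣q∣ p q) (cong (_* ∣ q ∣) (0≤p⇒∣p∣≡p 0≤p))

  ∣-∣-sym : ∀ x y → ∣ x - y ∣ ≡ ∣ y - x ∣
  ∣-∣-sym x y = trans (sym (∣-p∣≡∣p∣ (x - y))) (cong ∣_∣ (solve 2 (λ x y → :- (x :- y) := y :- x) refl x y))

  ∣-∣-triangle : ∀ x y z → ∣ x - z ∣ ≤ ∣ x - y ∣ + ∣ y - z ∣
  ∣-∣-triangle x y z = subst (_≤ ∣ x - y ∣ + ∣ y - z ∣)
    (cong ∣_∣ (solve 3 (λ x y z → (x :- y) :+ (y :- z) := x :- z) refl x y z)) (∣p+q∣≤∣p∣+∣q∣ (x - y) (y - z))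

  interval : ∀ {lo hi p q} → lo ≤ p → p ≤ hi → lo ≤ q → q ≤ hi → ∣ p - q ∣ ≤ hi - lo
  interval {lo} {hi} {p} {q} lo≤p p≤hi lo≤q q≤hi = ∣∣-≤
    (+-mono-≤ p≤hi (neg-antimono-≤ lo≤q))
    (≤-trans (≤-reflexive (solve 2 (λ p q → :- (p :- q) := q :- p) refl p q))
             (+-mono-≤ q≤hi (neg-antimono-≤ lo≤p)))

  open FiniteSums (CommutativeRing.commutativeSemiring +-*-commutativeRing) public

  ∑-mono : ∀ n {F G : ℕ → ℚ} → (∀ j → j ℕ.< n → F j ≤ G j) → ∑ n F ≤ ∑ n G
  ∑-mono zero    h = ≤-refl
  ∑-mono (suc n) h = +-mono-≤ (h n ℕP.≤-refl) (∑-mono n (λ j j<n → h j (ℕP.m<n⇒m<1+n j<n)))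

  ∑-nonNeg : ∀ n {F : ℕ → ℚ} → (∀ j → j ℕ.< n → 0ℚ ≤ F j) → 0ℚ ≤ ∑ n F
  ∑-nonNeg zero    h = ≤-refl
  ∑-nonNeg (suc n) h = +-mono-≤ (h n ℕP.≤-refl) (∑-nonNeg n (λ j j<n → h j (ℕP.m<n⇒m<1+n j<n)))

  ∑-∣∣ : ∀ n (F : ℕ → ℚ) → ∣ ∑ n F ∣ ≤ ∑ n (λ j → ∣ F j ∣)
  ∑-∣∣ zero    F = ≤-refl
  ∑-∣∣ (suc n) F = ≤-trans (∣p+q∣≤∣p∣+∣q∣ (F n) (∑ n F)) (+-monoʳ-≤ ∣ F n ∣ (∑-∣∣ n F))

  ∑-- : ∀ n (F G : ℕ → ℚ) → ∑ n (λ j → F j - G j) ≡ ∑ n F - ∑ n G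
  ∑-- zero    F G = refl
  ∑-- (suc n) F G = trans (cong (_+_ (F n - G n)) (∑-- n F G))
    (solve 4 (λ a b c d → (a :- b) :+ (c :- d) := (a :+ c) :- (b :+ d)) refl (F n) (G n) (∑ n F) (∑ n G))

  ι-∑ : ∀ n (F : ℕ → ℕ) → ι (ℕSums.∑ n F) ≡ ∑ n (λ j → ι (F j))
  ι-∑ zero    F = ι-0
  ι-∑ (suc n) F = trans (ι-+ (F n) (ℕSums.∑ n F)) (cong (_+_ (ι (F n))) (ι-∑ n F))

-- Normalised coefficients c_n = a_n/n! and their ratios.
module Normalisation where

  open Summation
  open OrderedBell using (a; a-rec; a-pos)
  open Rationals
  open import Data.Nat as ℕ using (ℕ; suc; _!)
  import Data.Nat.Properties as ℕP
  open import Data.Nat.Properties using (_!≢0; _!*_!≢0)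
  open import Data.Nat.Combinatorics using (_C_; nCk≡n!/k![n-k]!; k![n∸k]!∣n!)
  open import Data.Nat.DivMod using (m/n*n≡m)
  open import Data.Rational
  open import Data.Rational.Properties
  open import Data.Rational.Solver using (module +-*-Solver)
  open import Relation.Binary.PropositionalEquality
  open +-*-Solver

  C-factorials : ∀ {n k} → k ℕ.≤ n → (n C k) ℕ.* (k ! ℕ.* (n ℕ.∸ k) !) ≡ n !
  C-factorials {n} {k} k≤n = trans
    (cong (ℕ._* (k ! ℕ.* (n ℕ.∸ k) !)) (nCk≡n!/k![n-k]! k≤n))
    (m/n*n≡m {{k !* (n ℕ.∸ k) !≢0}} (k![n∸k]!∣n! k≤n))

  ι!-nonZero : ∀ n → NonZero (ι (n !))
  ι!-nonZero n = pos⇒nz (ι-pos (n !) {{n !≢0}})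

  ifac : ℕ → ℚ
  ifac n = (1/ ι (n !)) {{ι!-nonZero n}}

  ifac-pos : ∀ n → 0ℚ < ifac n
  ifac-pos n = 1/-pos (ι (n !)) {{ι!-nonZero n}} (ι-pos (n !) {{n !≢0}})

  ifac-nonNeg : ∀ n → 0ℚ ≤ ifac n
  ifac-nonNeg n = <⇒≤ (ifac-pos n)

  ifac-inv : ∀ n → ι (n !) * ifac n ≡ 1ℚ
  ifac-inv n = *-inverseʳ (ι (n !)) {{ι!-nonZero n}}

  ifac-suc : ∀ n → ifac (suc n) ≡ ifac n * 1/ ι (suc n)
  ifac-suc n = trans (sym (*-identityˡ (ifac (suc n))))
    (/-split 1ℚ (ι (n !)) (ι (suc n)) (ι (suc n !)) {{ι!-nonZero n}} {{_}} {{ι!-nonZero (suc n)}}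
      (trans (*-identityˡ _) (trans (*-comm (ι (n !)) (ι (suc n))) (sym (ι-* (suc n) (n !))))))

  C-ifac : ∀ {N j} → j ℕ.≤ N → ι (N C j) * ifac N ≡ ifac j * ifac (N ℕ.∸ j)
  C-ifac {N} {j} j≤N = /-split (ι (N C j)) (ι (j !)) (ι ((N ℕ.∸ j) !)) (ι (N !))
    {{ι!-nonZero j}} {{ι!-nonZero (N ℕ.∸ j)}} {{ι!-nonZero N}}
    (trans (cong (ι (N C j) *_) (sym (ι-* (j !) ((N ℕ.∸ j) !))))
           (trans (sym (ι-* (N C j) _)) (cong ι (C-factorials j≤N))))

  -- The exponential-generating-function coefficients  c_n = a_n / n!,  and their
  -- successive ratios  σ_n = c_n / c_(n+1)  and  V_n = c_(n+1) / c_n = 1/σ_n,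
  -- as well as the ratios  r i n = c_i / c_n.  (c is opaque only to keep terms small.)
  opaque
    c : ℕ → ℚ
    c n = ι (a n) * ifac n

    c-def : ∀ n → c n ≡ ι (a n) * ifac n
    c-def n = refl

  c-pos : ∀ n → 0ℚ < c n
  c-pos n = subst (0ℚ <_) (sym (c-def n)) (*-pos (ι-pos (a n) {{ℕ.>-nonZero (a-pos n)}}) (ifac-pos n))

  instance
    c-nonZero : ∀ {n} → NonZero (c n)
    c-nonZero {n} = pos⇒nz (c-pos n)

  σ V : ℕ → ℚ
  σ n = c n * 1/ c (suc n)
  V n = c (suc n) * 1/ c n

  r : ℕ → ℕ → ℚ
  r i n = c i * 1/ c n

  σ-pos : ∀ n → 0ℚ < σ n
  σ-pos n = *-pos (c-pos n) (1/-pos (c (suc n)) (c-pos (suc n)))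

  σ-nonNeg : ∀ n → 0ℚ ≤ σ n
  σ-nonNeg n = <⇒≤ (σ-pos n)

  r-nonNeg : ∀ i n → 0ℚ ≤ r i n
  r-nonNeg i n = <⇒≤ (*-pos (c-pos i) (1/-pos (c n) (c-pos n)))

  r-diag : ∀ n → r n n ≡ 1ℚ
  r-diag n = *-inverseʳ (c n)

  σV : ∀ n → σ n * V n ≡ 1ℚ
  σV n = begin
    c n * 1/ c (suc n) * (c (suc n) * 1/ c n)
      ≡⟨ solve 4 (λ x y z w → x :* y :* (z :* w) := (z :* y) :* (x :* w)) refl (c n) (1/ c (suc n)) (c (suc n)) (1/ c n) ⟩
    (c (suc n) * 1/ c (suc n)) * (c n * 1/ c n)
      ≡⟨ cong₂ _*_ (*-inverseʳ (c (suc n))) (*-inverseʳ (c n)) ⟩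
    1ℚ * 1ℚ ≡⟨ *-identityˡ 1ℚ ⟩
    1ℚ ∎
    where open ≡-Reasoning

  r-suc : ∀ i n → r i (suc n) ≡ σ n * r i n
  r-suc i n = begin
    c i * 1/ c (suc n)                      ≡⟨ *-identityʳ _ ⟨
    c i * 1/ c (suc n) * 1ℚ                 ≡⟨ cong (c i * 1/ c (suc n) *_) (*-inverseʳ (c n)) ⟨
    c i * 1/ c (suc n) * (c n * 1/ c n)     ≡⟨ solve 4 (λ x y z w → x :* y :* (z :* w) := z :* y :* (x :* w)) refl (c i) (1/ c (suc n)) (c n) (1/ c n) ⟩
    c n * 1/ c (suc n) * (c i * 1/ c n)     ∎
    where open ≡-Reasoning

  c-rec : ∀ n → c (suc n) ≡ ∑ (suc n) (λ j → c j * ifac (suc n ℕ.∸ j))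
  c-rec n = begin
    c (suc n)
      ≡⟨ c-def (suc n) ⟩
    ι (a (suc n)) * ifac (suc n)
      ≡⟨ cong (λ z → ι z * ifac (suc n)) (a-rec n) ⟩
    ι (ℕSums.∑ (suc n) (λ j → (suc n C j) ℕ.* a j)) * ifac (suc n)
      ≡⟨ cong (_* ifac (suc n)) (ι-∑ (suc n) (λ j → (suc n C j) ℕ.* a j)) ⟩
    ∑ (suc n) (λ j → ι ((suc n C j) ℕ.* a j)) * ifac (suc n)
      ≡⟨ ∑-*ʳ (suc n) (λ j → ι ((suc n C j) ℕ.* a j)) (ifac (suc n)) ⟨
    ∑ (suc n) (λ j → ι ((suc n C j) ℕ.* a j) * ifac (suc n))
      ≡⟨ ∑-cong (suc n) term ⟩
    ∑ (suc n) (λ j → c j * ifac (suc n ℕ.∸ j)) ∎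
    where
    open ≡-Reasoning
    term : ∀ j → j ℕ.< suc n → ι ((suc n C j) ℕ.* a j) * ifac (suc n) ≡ c j * ifac (suc n ℕ.∸ j)
    term j j<1+n = begin
      ι ((suc n C j) ℕ.* a j) * ifac (suc n)          ≡⟨ cong (_* ifac (suc n)) (ι-* (suc n C j) (a j)) ⟩
      ι (suc n C j) * ι (a j) * ifac (suc n)          ≡⟨ solve 3 (λ x y z → x :* y :* z := y :* (x :* z)) refl (ι (suc n C j)) (ι (a j)) (ifac (suc n)) ⟩
      ι (a j) * (ι (suc n C j) * ifac (suc n))        ≡⟨ cong (ι (a j) *_) (C-ifac (ℕP.<⇒≤ j<1+n)) ⟩
      ι (a j) * (ifac j * ifac (suc n ℕ.∸ j))         ≡⟨ *-assoc (ι (a j)) _ _ ⟨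
      ι (a j) * ifac j * ifac (suc n ℕ.∸ j)           ≡⟨ cong (_* ifac (suc n ℕ.∸ j)) (c-def j) ⟨
      c j * ifac (suc n ℕ.∸ j)                        ∎

  V-sum : ∀ n → V n ≡ ∑ (suc n) (λ j → r j n * ifac (suc n ℕ.∸ j))
  V-sum n = begin
    c (suc n) * 1/ c n
      ≡⟨ cong (_* 1/ c n) (c-rec n) ⟩
    ∑ (suc n) (λ j → c j * ifac (suc n ℕ.∸ j)) * 1/ c n
      ≡⟨ ∑-*ʳ (suc n) (λ j → c j * ifac (suc n ℕ.∸ j)) (1/ c n) ⟨
    ∑ (suc n) (λ j → c j * ifac (suc n ℕ.∸ j) * 1/ c n)
      ≡⟨ ∑-cong (suc n) (λ j _ → solve 3 (λ x y z → x :* y :* z := x :* z :* y) refl (c j) (ifac (suc n ℕ.∸ j)) (1/ c n)) ⟩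
    ∑ (suc n) (λ j → r j n * ifac (suc n ℕ.∸ j)) ∎
    where open ≡-Reasoning

-- 1/2 ≤ σ_n ≤ 1 and σ_(n+1) ≤ 4/5.
module RatioBounds where

  open Rationals
  open Normalisation
  open import Data.Nat as ℕ using (ℕ; zero; suc)
  import Data.Nat.Properties as ℕP
  open import Data.Integer using (+_)
  open import Data.Rational
  open import Data.Rational.Properties
  open import Data.Rational.Solver using (module +-*-Solver)
  open import Relation.Binary.PropositionalEquality
  open +-*-Solver

  opaque
    unfolding ι

    ifac-1 : ifac 1 ≡ 1ℚ
    ifac-1 = refl

    ifac-2 : ifac 2 ≡ ½
    ifac-2 = refl

  V-term-nonNeg : ∀ n j → 0ℚ ≤ r j n * ifac (suc n ℕ.∸ j)
  V-term-nonNeg n j = *-nonNeg (r-nonNeg j n) (ifac-nonNeg (suc n ℕ.∸ j))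

  V-term-top : ∀ n → r n n * ifac (suc n ℕ.∸ n) ≡ 1ℚ
  V-term-top n = trans (cong₂ _*_ (r-diag n) (trans (cong ifac (ℕP.m+n∸n≡m 1 n)) ifac-1)) (*-identityˡ 1ℚ)

  -- The top summand alone gives  V_n ≥ 1.
  V≥1 : ∀ n → 1ℚ ≤ V n
  V≥1 n = begin
    1ℚ                                                 ≡⟨ V-term-top n ⟨
    r n n * ifac (suc n ℕ.∸ n)                         ≤⟨ p≤p+q _ (∑-nonNeg n (λ j _ → V-term-nonNeg n j)) ⟩
    ∑ (suc n) (λ j → r j n * ifac (suc n ℕ.∸ j))       ≡⟨ V-sum n ⟨
    V n                                                ∎
    where open ≤-Reasoning

  σ≤1 : ∀ n → σ n ≤ 1ℚ
  σ≤1 n = begin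
    σ n          ≡⟨ *-identityʳ (σ n) ⟨
    σ n * 1ℚ     ≤⟨ *-monoˡ (σ n) (σ-nonNeg n) (V≥1 n) ⟩
    σ n * V n    ≡⟨ σV n ⟩
    1ℚ           ∎
    where open ≤-Reasoning

  r≤1 : ∀ {i n} → i ℕ.≤ n → r i n ≤ 1ℚ
  r≤1 {i} {n} i≤n = subst (λ m → r i m ≤ 1ℚ) (ℕP.m+[n∸m]≡n i≤n) (above i (n ℕ.∸ i))
    where
    above : ∀ i k → r i (i ℕ.+ k) ≤ 1ℚ
    above i zero    rewrite ℕP.+-identityʳ i = ≤-reflexive (r-diag i)
    above i (suc k) rewrite ℕP.+-suc i k = begin
      r i (suc (i ℕ.+ k))          ≡⟨ r-suc i (i ℕ.+ k) ⟩
      σ (i ℕ.+ k) * r i (i ℕ.+ k)  ≤⟨ *-mono (σ-nonNeg _) (r-nonNeg i _) (σ≤1 _) (above i k) ⟩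
      1ℚ * 1ℚ                      ≡⟨ *-identityˡ 1ℚ ⟩
      1ℚ                           ∎
      where open ≤-Reasoning

  ifac-halve : ∀ n → ifac (suc (suc n)) + ifac (suc (suc n)) ≤ ifac (suc n)
  ifac-halve n = begin
    ifac (2 ℕ.+ n) + ifac (2 ℕ.+ n)     ≡⟨ cong (λ z → z + z) (ifac-suc (suc n)) ⟩
    ifac (suc n) * y + ifac (suc n) * y ≡⟨ *-distribˡ-+ (ifac (suc n)) y y ⟨
    ifac (suc n) * (y + y)              ≤⟨ *-monoˡ (ifac (suc n)) (ifac-nonNeg (suc n)) y+y≤1 ⟩
    ifac (suc n) * 1ℚ                   ≡⟨ *-identityʳ _ ⟩
    ifac (suc n)                        ∎
    where
    open ≤-Reasoning
    y = 1/ ι (2 ℕ.+ n)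
    y+y≤1 : y + y ≤ 1ℚ
    y+y≤1 = begin
      y + y                 ≡⟨ solve 1 (λ y → y :+ y := y :* con (+ 2 / 1)) refl y ⟩
      y * (+ 2 / 1)         ≡⟨ cong (y *_) (ι-def 2) ⟨
      y * ι 2               ≤⟨ *-monoˡ y (1/-nonNeg _ (ι-pos (2 ℕ.+ n))) (ι-mono (ℕP.m≤m+n 2 n)) ⟩
      y * ι (2 ℕ.+ n)       ≡⟨ *-inverseˡ (ι (2 ℕ.+ n)) ⟩
      1ℚ                    ∎

  ifac-sum : ℕ → ℚ
  ifac-sum n = ∑ (suc n) (λ j → ifac (suc n ℕ.∸ j))

  ifac-sum-bound : ∀ n → ifac-sum n + ifac (suc n) ≤ + 2 / 1
  ifac-sum-bound zero    = ≤-reflexive (cong (λ z → (z + 0ℚ) + z) ifac-1)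
  ifac-sum-bound (suc n) = begin
    ifac-sum (suc n) + x          ≡⟨ cong (_+ x) (∑-shift (suc n) (λ j → ifac (2 ℕ.+ n ℕ.∸ j))) ⟩
    x + ifac-sum n + x            ≡⟨ solve 2 (λ x u → x :+ u :+ x := (x :+ x) :+ u) refl x (ifac-sum n) ⟩
    (x + x) + ifac-sum n          ≤⟨ +-monoˡ-≤ (ifac-sum n) (ifac-halve n) ⟩
    ifac (suc n) + ifac-sum n     ≡⟨ +-comm (ifac (suc n)) (ifac-sum n) ⟩
    ifac-sum n + ifac (suc n)     ≤⟨ ifac-sum-bound n ⟩
    + 2 / 1                       ∎
    where
    open ≤-Reasoning
    x = ifac (2 ℕ.+ n)

  V≤2 : ∀ n → V n ≤ + 2 / 1
  V≤2 n = begin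
    V n                                             ≡⟨ V-sum n ⟩
    ∑ (suc n) (λ j → r j n * ifac (suc n ℕ.∸ j))    ≤⟨ ∑-mono (suc n) term ⟩
    ifac-sum n                                      ≤⟨ p≤p+q (ifac-sum n) (ifac-nonNeg (suc n)) ⟩
    ifac-sum n + ifac (suc n)                       ≤⟨ ifac-sum-bound n ⟩
    + 2 / 1                                         ∎
    where
    open ≤-Reasoning
    term : ∀ j → j ℕ.< suc n → r j n * ifac (suc n ℕ.∸ j) ≤ ifac (suc n ℕ.∸ j)
    term j j<1+n = ≤-trans (*-monoʳ (ifac (suc n ℕ.∸ j)) (ifac-nonNeg (suc n ℕ.∸ j)) (r≤1 (ℕP.≤-pred j<1+n)))
                           (≤-reflexive (*-identityˡ _))

  σ≥½ : ∀ n → ½ ≤ σ n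
  σ≥½ n = begin
    ½                        ≡⟨ *-identityʳ ½ ⟨
    ½ * 1ℚ                   ≡⟨ cong (½ *_) (σV n) ⟨
    ½ * (σ n * V n)          ≤⟨ *-monoˡ ½ (nonNegative⁻¹ ½) (*-monoˡ (σ n) (σ-nonNeg n) (V≤2 n)) ⟩
    ½ * (σ n * (+ 2 / 1))    ≡⟨ solve 1 (λ s → con ½ :* (s :* con (+ 2 / 1)) := s) refl (σ n) ⟩
    σ n                      ∎
    where open ≤-Reasoning

  -- From index 1 on, the two top summands of V give  V_(n+1) ≥ 1 + σ_n/2 ≥ 5/4,
  -- hence  σ_(n+1) ≤ 4/5.
  V-suc≥5/4 : ∀ n → + 5 / 4 ≤ V (suc n)
  V-suc≥5/4 n = begin
    + 5 / 4                   ≡⟨ refl ⟩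
    1ℚ + ½ * ½                ≤⟨ +-monoʳ-≤ 1ℚ (*-monoʳ ½ (nonNegative⁻¹ ½) (σ≥½ n)) ⟩
    1ℚ + σ n * ½              ≡⟨ cong₂ _+_ (V-term-top (suc n)) (cong₂ _*_ r-below (trans (cong ifac (ℕP.m+n∸n≡m 2 n)) ifac-2)) ⟨
    F (suc n) + F n           ≤⟨ +-monoʳ-≤ (F (suc n)) (p≤p+q (F n) (∑-nonNeg n (λ j _ → V-term-nonNeg (suc n) j))) ⟩
    F (suc n) + (F n + ∑ n F) ≡⟨ V-sum (suc n) ⟨
    V (suc n)                 ∎
    where
    open ≤-Reasoning
    F : ℕ → ℚ
    F j = r j (suc n) * ifac (2 ℕ.+ n ℕ.∸ j)
    r-below : r n (suc n) ≡ σ n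
    r-below = trans (r-suc n n) (trans (cong (σ n *_) (r-diag n)) (*-identityʳ (σ n)))

  σ-suc≤4/5 : ∀ n → σ (suc n) ≤ + 4 / 5
  σ-suc≤4/5 n = begin
    σ (suc n)                              ≡⟨ solve 1 (λ s → s := s :* con (+ 5 / 4) :* con (+ 4 / 5)) refl (σ (suc n)) ⟩
    σ (suc n) * (+ 5 / 4) * (+ 4 / 5)      ≤⟨ *-monoʳ (+ 4 / 5) (nonNegative⁻¹ _) (*-monoˡ (σ (suc n)) (σ-nonNeg _) (V-suc≥5/4 n)) ⟩
    σ (suc n) * V (suc n) * (+ 4 / 5)      ≡⟨ cong (_* (+ 4 / 5)) (σV (suc n)) ⟩
    1ℚ * (+ 4 / 5)                         ≡⟨ *-identityˡ _ ⟩
    + 4 / 5                                ∎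
    where open ≤-Reasoning

-- |σ_(n+1) − σ_n| ≤ θ^n with θ = 9/10.
module Contraction where

  open Rationals
  open Normalisation
  open RatioBounds
  open import Data.Nat as ℕ using (ℕ; zero; suc)
  import Data.Nat.Properties as ℕP
  open import Data.Nat.Induction using (<-rec)
  open import Data.Integer using (+_)
  open import Data.Rational
  open import Data.Rational.Properties
  open import Data.Rational.Solver using (module +-*-Solver)
  open import Relation.Binary.PropositionalEquality
  open +-*-Solver

  -- The contraction factor θ = 9/10 and its inverse χ = 10/9 (opaque, so that
  -- they are only evaluated in the explicit numerical checks).
  opaque
    θ χ : ℚ
    θ = + 9 / 10
    χ = + 10 / 9

    θ-def : θ ≡ + 9 / 10
    θ-def = refl

    χ-def : χ ≡ + 10 / 9
    χ-def = refl

    θχ : θ * χ ≡ 1ℚ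
    θχ = refl

    θ-nonNeg : 0ℚ ≤ θ
    θ-nonNeg = nonNegative⁻¹ θ

    θ≤1 : θ ≤ 1ℚ
    θ≤1 = ≤ᵇ⇒≤ _

    χ-nonNeg : 0ℚ ≤ χ
    χ-nonNeg = nonNegative⁻¹ χ

  ^-nonNeg : ∀ {x} n → 0ℚ ≤ x → 0ℚ ≤ x ^ n
  ^-nonNeg zero    0≤x = nonNegative⁻¹ 1ℚ
  ^-nonNeg (suc n) 0≤x = *-nonNeg 0≤x (^-nonNeg n 0≤x)

  θ^-nonNeg : ∀ n → 0ℚ ≤ θ ^ n
  θ^-nonNeg n = ^-nonNeg n θ-nonNeg

  θ^≤1 : ∀ n → θ ^ n ≤ 1ℚ
  θ^≤1 zero    = ≤-refl
  θ^≤1 (suc n) = ≤-trans (*-mono θ-nonNeg (θ^-nonNeg n) θ≤1 (θ^≤1 n)) (≤-reflexive (*-identityˡ 1ℚ))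

  θ^-antitone : ∀ j k → θ ^ (j ℕ.+ k) ≤ θ ^ j
  θ^-antitone j k = begin
    θ ^ (j ℕ.+ k)     ≡⟨ ^-homo-* θ j k ⟩
    θ ^ j * θ ^ k     ≤⟨ *-monoˡ (θ ^ j) (θ^-nonNeg j) (θ^≤1 k) ⟩
    θ ^ j * 1ℚ        ≡⟨ *-identityʳ (θ ^ j) ⟩
    θ ^ j             ∎
    where open ≤-Reasoning

  θ^-shift : ∀ j k → θ ^ j ≡ θ ^ (j ℕ.+ k) * χ ^ k
  θ^-shift j k = begin
    θ ^ j                        ≡⟨ *-identityʳ (θ ^ j) ⟨
    θ ^ j * 1ℚ                   ≡⟨ cong (θ ^ j *_) (cancel k) ⟨
    θ ^ j * (θ ^ k * χ ^ k)      ≡⟨ *-assoc (θ ^ j) (θ ^ k) (χ ^ k) ⟨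
    θ ^ j * θ ^ k * χ ^ k        ≡⟨ cong (_* χ ^ k) (^-homo-* θ j k) ⟨
    θ ^ (j ℕ.+ k) * χ ^ k        ∎
    where
    open ≡-Reasoning
    cancel : ∀ k → θ ^ k * χ ^ k ≡ 1ℚ
    cancel zero    = refl
    cancel (suc k) = begin
      θ * θ ^ k * (χ * χ ^ k)        ≡⟨ solve 4 (λ a b c e → a :* b :* (c :* e) := (a :* c) :* (b :* e)) refl θ (θ ^ k) χ (χ ^ k) ⟩
      θ * χ * (θ ^ k * χ ^ k)        ≡⟨ cong₂ _*_ θχ (cancel k) ⟩
      1ℚ * 1ℚ                        ≡⟨ *-identityˡ 1ℚ ⟩
      1ℚ                             ∎

  d : ℕ → ℚ
  d n = ∣ σ (suc n) - σ n ∣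

  σ-diff : ∀ n → σ (suc n) - σ n ≡ σ n * σ (suc n) * (V n - V (suc n))
  σ-diff n = begin
    σ (suc n) - σ n                                           ≡⟨ cong₂ _-_ (*-identityʳ (σ (suc n))) (*-identityʳ (σ n)) ⟨
    σ (suc n) * 1ℚ - σ n * 1ℚ                                 ≡⟨ cong₂ (λ u v → σ (suc n) * u - σ n * v) (σV n) (σV (suc n)) ⟨
    σ (suc n) * (σ n * V n) - σ n * (σ (suc n) * V (suc n))   ≡⟨ solve 4 (λ s t v w → t :* (s :* v) :- s :* (t :* w) := s :* t :* (v :- w)) refl (σ n) (σ (suc n)) (V n) (V (suc n)) ⟩
    σ n * σ (suc n) * (V n - V (suc n))                       ∎
    where open ≡-Reasoning

  E : ℕ → ℕ → ℚ
  E n j = r (suc j) (suc n) - r j n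

  V-diff : ∀ n → V (suc n) - V n ≡ r 0 (suc n) * ifac (2 ℕ.+ n) + ∑ (suc n) (λ j → E n j * ifac (suc n ℕ.∸ j))
  V-diff n = begin
    V (suc n) - V n
      ≡⟨ cong₂ _-_ (trans (V-sum (suc n)) (∑-shift (suc n) (λ j → r j (suc n) * ifac (2 ℕ.+ n ℕ.∸ j)))) (V-sum n) ⟩
    (X + S₁) - S₂
      ≡⟨ +-assoc X S₁ (- S₂) ⟩
    X + (S₁ - S₂)
      ≡⟨ cong (_+_ X) (∑-- (suc n) (λ j → r (suc j) (suc n) * ifac (suc n ℕ.∸ j)) (λ j → r j n * ifac (suc n ℕ.∸ j))) ⟨
    X + ∑ (suc n) (λ j → r (suc j) (suc n) * ifac (suc n ℕ.∸ j) - r j n * ifac (suc n ℕ.∸ j))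
      ≡⟨ cong (_+_ X) (∑-cong (suc n) (λ j _ → *-distribʳ-- (ifac (suc n ℕ.∸ j)) (r (suc j) (suc n)) (r j n))) ⟨
    X + ∑ (suc n) (λ j → E n j * ifac (suc n ℕ.∸ j)) ∎
    where
    open ≡-Reasoning
    X  = r 0 (suc n) * ifac (2 ℕ.+ n)
    S₁ = ∑ (suc n) (λ j → r (suc j) (suc n) * ifac (suc n ℕ.∸ j))
    S₂ = ∑ (suc n) (λ j → r j n * ifac (suc n ℕ.∸ j))
    *-distribʳ-- : ∀ z p q → (p - q) * z ≡ p * z - q * z
    *-distribʳ-- z p q = solve 3 (λ z p q → (p :- q) :* z := p :* z :- q :* z) refl z p q

  Decays : ℕ → Set
  Decays n = ∀ {i} → i ℕ.< n → d i ≤ θ ^ i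

  -- If  d_i ≤ θ^i  for all i < j+k, then  |E_(j+k),j| ≤ k θ^j:  each step of the
  -- telescoping product r j m = σ_(m-1) ⋯ σ_j changes by at most one d-term.
  E-bound : ∀ j k → Decays (j ℕ.+ k) → ∣ E (j ℕ.+ k) j ∣ ≤ ι k * θ ^ j
  E-bound j zero h rewrite ℕP.+-identityʳ j = begin
    ∣ r (suc j) (suc j) - r j j ∣    ≡⟨ cong₂ (λ u v → ∣ u - v ∣) (r-diag (suc j)) (r-diag j) ⟩
    0ℚ                               ≡⟨ *-zeroˡ (θ ^ j) ⟨
    0ℚ * θ ^ j                       ≡⟨ cong (_* θ ^ j) ι-0 ⟨
    ι 0 * θ ^ j                      ∎
    where open ≤-Reasoning
  E-bound j (suc k) h rewrite ℕP.+-suc j k = begin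
    ∣ E (suc m) j ∣                                     ≡⟨ cong ∣_∣ step ⟩
    ∣ σ (suc m) * E m j + (σ (suc m) - σ m) * r j m ∣   ≤⟨ ∣p+q∣≤∣p∣+∣q∣ (σ (suc m) * E m j) ((σ (suc m) - σ m) * r j m) ⟩
    ∣ σ (suc m) * E m j ∣ + ∣ (σ (suc m) - σ m) * r j m ∣
      ≡⟨ cong₂ _+_ (∣nonNeg*∣ (σ (suc m)) (E m j) (σ-nonNeg _))
                   (trans (∣p*q∣≡∣p∣*∣q∣ (σ (suc m) - σ m) (r j m)) (cong (d m *_) (0≤p⇒∣p∣≡p (r-nonNeg j m)))) ⟩
    σ (suc m) * ∣ E m j ∣ + d m * r j m
      ≤⟨ +-mono-≤ (*-monoʳ ∣ E m j ∣ (0≤∣p∣ (E m j)) (σ≤1 (suc m))) (*-monoˡ (d m) (0≤∣p∣ _) (r≤1 (ℕP.m≤m+n j k))) ⟩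
    1ℚ * ∣ E m j ∣ + d m * 1ℚ                           ≡⟨ cong₂ _+_ (*-identityˡ ∣ E m j ∣) (*-identityʳ (d m)) ⟩
    ∣ E m j ∣ + d m                                     ≤⟨ +-mono-≤ (E-bound j k (λ i<m → h (ℕP.m<n⇒m<1+n i<m))) (h ℕP.≤-refl) ⟩
    ι k * θ ^ j + θ ^ m                                 ≤⟨ +-monoʳ-≤ (ι k * θ ^ j) (θ^-antitone j k) ⟩
    ι k * θ ^ j + θ ^ j                                 ≡⟨ solve 2 (λ x t → x :* t :+ t := (con 1ℚ :+ x) :* t) refl (ι k) (θ ^ j) ⟩
    (1ℚ + ι k) * θ ^ j                                  ≡⟨ cong (λ z → (z + ι k) * θ ^ j) ι-1 ⟨
    (ι 1 + ι k) * θ ^ j                                 ≡⟨ cong (_* θ ^ j) (ι-+ 1 k) ⟨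
    ι (suc k) * θ ^ j                                   ∎
    where
    open ≤-Reasoning
    m = j ℕ.+ k
    step : E (suc m) j ≡ σ (suc m) * E m j + (σ (suc m) - σ m) * r j m
    step = begin-equality
      r (suc j) (suc (suc m)) - r j (suc m)     ≡⟨ cong₂ _-_ (r-suc (suc j) (suc m)) (r-suc j m) ⟩
      σ (suc m) * r (suc j) (suc m) - σ m * r j m
        ≡⟨ solve 4 (λ s t p q → s :* p :- t :* q := s :* (p :- q) :+ (s :- t) :* q) refl (σ (suc m)) (σ m) (r (suc j) (suc m)) (r j m) ⟩
      σ (suc m) * E m j + (σ (suc m) - σ m) * r j m ∎

  -- The weights  t_k = k χ^k / (k+1)!  and their partial sums  W_n = Σ_{k ≤ n} t_k,
  -- which bound the error sum in V_(n+1) − V_n once θ^n is factored out.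
  t : ℕ → ℚ
  t k = ι k * χ ^ k * ifac (suc k)

  W : ℕ → ℚ
  W n = ∑ (suc n) (λ j → t (n ℕ.∸ j))

  t-nonNeg : ∀ k → 0ℚ ≤ t k
  t-nonNeg k = *-nonNeg (*-nonNeg (ι-nonNeg k) (^-nonNeg k χ-nonNeg)) (ifac-nonNeg (suc k))

  W-suc : ∀ n → W (suc n) ≡ t (suc n) + W n
  W-suc n = ∑-shift (suc n) (λ j → t (suc n ℕ.∸ j))

  opaque
    unfolding θ ι

    W0 : W 0 ≤ + 21 / 16
    W0 = ≤ᵇ⇒≤ _

    W1 : W 1 ≤ + 21 / 16
    W1 = ≤ᵇ⇒≤ _

    W2 : W 2 + (+ 5 / 7) * t 2 ≤ + 21 / 16
    W2 = ≤ᵇ⇒≤ _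

  private
    quadratic : ∀ m → 40 ℕ.* (3 ℕ.+ m) ℕ.≤ 15 ℕ.* ((2 ℕ.+ m) ℕ.* (4 ℕ.+ m))
    quadratic m = ℕP.≤-trans (ℕP.m≤m+n (40 ℕ.* (3 ℕ.+ m)) (15 ℕ.* (m ℕ.* m) ℕ.+ 50 ℕ.* m)) (ℕP.≤-reflexive (expand m))
      where
      open import Data.Nat.Solver using (module +-*-Solver)
      open Data.Nat.Solver.+-*-Solver using () renaming (solve to ℕsolve; _:+_ to _⊕_; _:*_ to _⊛_; con to ℕcon; _:=_ to _≐_)
      expand : ∀ m → 40 ℕ.* (3 ℕ.+ m) ℕ.+ (15 ℕ.* (m ℕ.* m) ℕ.+ 50 ℕ.* m) ≡ 15 ℕ.* ((2 ℕ.+ m) ℕ.* (4 ℕ.+ m))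
      expand = ℕsolve 1 (λ m → ℕcon 40 ⊛ (ℕcon 3 ⊕ m) ⊕ (ℕcon 15 ⊛ (m ⊛ m) ⊕ ℕcon 50 ⊛ m) ≐ ℕcon 15 ⊛ ((ℕcon 2 ⊕ m) ⊛ (ℕcon 4 ⊕ m))) refl

    bracket : ∀ m → ι (3 ℕ.+ m) * χ ≤ (+ 5 / 12) * ι (2 ℕ.+ m) * ι (4 ℕ.+ m)
    bracket m = begin
      ι (3 ℕ.+ m) * χ                                       ≡⟨ cong (ι (3 ℕ.+ m) *_) χ-def ⟩
      ι (3 ℕ.+ m) * (+ 10 / 9)                              ≡⟨ solve 1 (λ x → x :* con (+ 10 / 9) := con (+ 1 / 36) :* (con (+ 40 / 1) :* x)) refl (ι (3 ℕ.+ m)) ⟩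
      (+ 1 / 36) * ((+ 40 / 1) * ι (3 ℕ.+ m))               ≡⟨ cong (λ z → (+ 1 / 36) * (z * ι (3 ℕ.+ m))) (ι-def 40) ⟨
      (+ 1 / 36) * (ι 40 * ι (3 ℕ.+ m))                     ≡⟨ cong ((+ 1 / 36) *_) (ι-* 40 (3 ℕ.+ m)) ⟨
      (+ 1 / 36) * ι (40 ℕ.* (3 ℕ.+ m))                     ≤⟨ *-monoˡ (+ 1 / 36) (nonNegative⁻¹ _) (ι-mono (quadratic m)) ⟩
      (+ 1 / 36) * ι (15 ℕ.* ((2 ℕ.+ m) ℕ.* (4 ℕ.+ m)))     ≡⟨ cong ((+ 1 / 36) *_) (trans (ι-* 15 _) (cong (ι 15 *_) (ι-* (2 ℕ.+ m) (4 ℕ.+ m)))) ⟩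
      (+ 1 / 36) * (ι 15 * (ι (2 ℕ.+ m) * ι (4 ℕ.+ m)))     ≡⟨ cong (λ z → (+ 1 / 36) * (z * (ι (2 ℕ.+ m) * ι (4 ℕ.+ m)))) (ι-def 15) ⟩
      (+ 1 / 36) * ((+ 15 / 1) * (ι (2 ℕ.+ m) * ι (4 ℕ.+ m)))
        ≡⟨ solve 2 (λ x y → con (+ 1 / 36) :* (con (+ 15 / 1) :* (x :* y)) := con (+ 5 / 12) :* x :* y) refl (ι (2 ℕ.+ m)) (ι (4 ℕ.+ m)) ⟩
      (+ 5 / 12) * ι (2 ℕ.+ m) * ι (4 ℕ.+ m)                ∎
      where open ≤-Reasoning

  t-ratio : ∀ m → t (3 ℕ.+ m) ≤ (+ 5 / 12) * t (2 ℕ.+ m)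
  t-ratio m = begin
    t (3 ℕ.+ m)
      ≡⟨ cong (ι (3 ℕ.+ m) * (χ * χ ^ n) *_) (ifac-suc (suc n)) ⟩
    ι (3 ℕ.+ m) * (χ * χ ^ n) * (ifac (suc n) * 1/ ι (4 ℕ.+ m))
      ≡⟨ solve 5 (λ a x p f i → a :* (x :* p) :* (f :* i) := a :* x :* i :* (p :* f)) refl (ι (3 ℕ.+ m)) χ (χ ^ n) (ifac (suc n)) (1/ ι (4 ℕ.+ m)) ⟩
    ι (3 ℕ.+ m) * χ * 1/ ι (4 ℕ.+ m) * Z
      ≤⟨ *-monoʳ Z (*-nonNeg (^-nonNeg n χ-nonNeg) (ifac-nonNeg (suc n)))
           (div-≤ (ι (3 ℕ.+ m) * χ) (ι (4 ℕ.+ m)) ((+ 5 / 12) * ι (2 ℕ.+ m)) (ι-pos (4 ℕ.+ m)) (bracket m)) ⟩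
    (+ 5 / 12) * ι (2 ℕ.+ m) * Z
      ≡⟨ solve 4 (λ c a p f → c :* a :* (p :* f) := c :* (a :* p :* f)) refl (+ 5 / 12) (ι (2 ℕ.+ m)) (χ ^ n) (ifac (suc n)) ⟩
    (+ 5 / 12) * t (2 ℕ.+ m) ∎
    where
    open ≤-Reasoning
    n = 2 ℕ.+ m
    Z = χ ^ n * ifac (suc n)

  -- The invariant  W_(m+2) + (5/7) t_(m+2) ≤ 21/16  propagates:  1 + 5/7 = 12/7  and
  -- (12/7)·(5/12) = 5/7.  It is checked numerically at m = 0.
  W-invariant : ∀ m → W (2 ℕ.+ m) + (+ 5 / 7) * t (2 ℕ.+ m) ≤ + 21 / 16
  W-invariant zero    = W2
  W-invariant (suc m) = begin
    W (3 ℕ.+ m) + (+ 5 / 7) * t (3 ℕ.+ m)               ≡⟨ cong (_+ (+ 5 / 7) * t (3 ℕ.+ m)) (W-suc (2 ℕ.+ m)) ⟩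
    t (3 ℕ.+ m) + W (2 ℕ.+ m) + (+ 5 / 7) * t (3 ℕ.+ m)
      ≡⟨ solve 2 (λ x w → x :+ w :+ con (+ 5 / 7) :* x := w :+ con (+ 12 / 7) :* x) refl (t (3 ℕ.+ m)) (W (2 ℕ.+ m)) ⟩
    W (2 ℕ.+ m) + (+ 12 / 7) * t (3 ℕ.+ m)              ≤⟨ +-monoʳ-≤ (W (2 ℕ.+ m)) (*-monoˡ (+ 12 / 7) (nonNegative⁻¹ _) (t-ratio m)) ⟩
    W (2 ℕ.+ m) + (+ 12 / 7) * ((+ 5 / 12) * t (2 ℕ.+ m))
      ≡⟨ cong (_+_ (W (2 ℕ.+ m))) (solve 1 (λ x → con (+ 12 / 7) :* (con (+ 5 / 12) :* x) := con (+ 5 / 7) :* x) refl (t (2 ℕ.+ m))) ⟩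
    W (2 ℕ.+ m) + (+ 5 / 7) * t (2 ℕ.+ m)               ≤⟨ W-invariant m ⟩
    + 21 / 16                                           ∎
    where open ≤-Reasoning

  W≤21/16 : ∀ n → W n ≤ + 21 / 16
  W≤21/16 zero          = W0
  W≤21/16 (suc zero)    = W1
  W≤21/16 (suc (suc m)) = ≤-trans (p≤p+q (W (2 ℕ.+ m)) (*-nonNeg (nonNegative⁻¹ _) (t-nonNeg (2 ℕ.+ m)))) (W-invariant m)

  opaque
    unfolding θ ι

    ifac3≤ : ifac 3 ≤ (+ 1 / 4) * θ ^ 1
    ifac3≤ = ≤ᵇ⇒≤ _

    1≤4θ : 1ℚ ≤ ι 4 * θ
    1≤4θ = ≤ᵇ⇒≤ _

  -- 1/(n+3)! ≤ (1/4) θ^(n+1):  each further factor 1/(n+4) is at most θ.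
  ifac-θ-bound : ∀ n → ifac (3 ℕ.+ n) ≤ (+ 1 / 4) * θ ^ suc n
  ifac-θ-bound zero    = ifac3≤
  ifac-θ-bound (suc n) = begin
    ifac (4 ℕ.+ n)                          ≡⟨ ifac-suc (3 ℕ.+ n) ⟩
    ifac (3 ℕ.+ n) * 1/ ι (4 ℕ.+ n)         ≤⟨ *-mono (ifac-nonNeg (3 ℕ.+ n)) (1/-nonNeg _ (ι-pos (4 ℕ.+ n))) (ifac-θ-bound n) 1/[n+4]≤θ ⟩
    (+ 1 / 4) * θ ^ suc n * θ               ≡⟨ solve 2 (λ p t → con (+ 1 / 4) :* p :* t := con (+ 1 / 4) :* (t :* p)) refl (θ ^ suc n) θ ⟩
    (+ 1 / 4) * θ ^ suc (suc n)             ∎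
    where
    open ≤-Reasoning
    1/[n+4]≤θ : 1/ ι (4 ℕ.+ n) ≤ θ
    1/[n+4]≤θ = 1/-≤ (ι (4 ℕ.+ n)) θ (ι-pos (4 ℕ.+ n)) (≤-trans 1≤4θ (*-monoʳ θ θ-nonNeg (ι-mono (ℕP.m≤m+n 4 n))))

  E-sum-bound : ∀ n → Decays n → ∑ (suc n) (λ j → ∣ E n j ∣ * ifac (suc n ℕ.∸ j)) ≤ θ ^ n * W n
  E-sum-bound n h = begin
    ∑ (suc n) (λ j → ∣ E n j ∣ * ifac (suc n ℕ.∸ j)) ≤⟨ ∑-mono (suc n) term ⟩
    ∑ (suc n) (λ j → θ ^ n * t (n ℕ.∸ j))           ≡⟨ ∑-*ˡ (suc n) (θ ^ n) (λ j → t (n ℕ.∸ j)) ⟩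
    θ ^ n * W n                                     ∎
    where
    open ≤-Reasoning
    term : ∀ j → j ℕ.< suc n → ∣ E n j ∣ * ifac (suc n ℕ.∸ j) ≤ θ ^ n * t (n ℕ.∸ j)
    term j j<1+n = begin
      ∣ E n j ∣ * ifac (suc n ℕ.∸ j)        ≡⟨ cong (λ z → ∣ E n j ∣ * ifac z) (ℕP.+-∸-assoc 1 j≤n) ⟩
      ∣ E n j ∣ * ifac (suc k)              ≤⟨ *-monoʳ (ifac (suc k)) (ifac-nonNeg (suc k)) E-bound′ ⟩
      ι k * θ ^ j * ifac (suc k)            ≡⟨ cong (λ z → ι k * z * ifac (suc k)) (trans (θ^-shift j k) (cong (λ z → θ ^ z * χ ^ k) j+k≡n)) ⟩
      ι k * (θ ^ n * χ ^ k) * ifac (suc k)  ≡⟨ solve 4 (λ i p x f → i :* (p :* x) :* f := p :* (i :* x :* f)) refl (ι k) (θ ^ n) (χ ^ k) (ifac (suc k)) ⟩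
      θ ^ n * t k                           ∎
      where
      j≤n = ℕP.≤-pred j<1+n
      k = n ℕ.∸ j
      j+k≡n = ℕP.m+[n∸m]≡n j≤n
      E-bound′ : ∣ E n j ∣ ≤ ι k * θ ^ j
      E-bound′ = subst (λ z → ∣ E z j ∣ ≤ ι k * θ ^ j) j+k≡n (E-bound j k (λ {i} i<j+k → h (subst (i ℕ.<_) j+k≡n i<j+k)))

  V-diff-bound : ∀ n → Decays n → ∣ V (suc n) - V n ∣ ≤ ifac (2 ℕ.+ n) + θ ^ n * W n
  V-diff-bound n h = begin
    ∣ V (suc n) - V n ∣                       ≡⟨ cong ∣_∣ (V-diff n) ⟩
    ∣ X + S ∣                                 ≤⟨ ∣p+q∣≤∣p∣+∣q∣ X S ⟩
    ∣ X ∣ + ∣ S ∣                             ≤⟨ +-mono-≤ ∣X∣≤ (≤-trans (∑-∣∣ (suc n) (λ j → E n j * ifac (suc n ℕ.∸ j))) (≤-reflexive ∑∣∣≡)) ⟩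
    ifac (2 ℕ.+ n) + ∑ (suc n) (λ j → ∣ E n j ∣ * ifac (suc n ℕ.∸ j))
                                              ≤⟨ +-monoʳ-≤ (ifac (2 ℕ.+ n)) (E-sum-bound n h) ⟩
    ifac (2 ℕ.+ n) + θ ^ n * W n              ∎
    where
    open ≤-Reasoning
    X = r 0 (suc n) * ifac (2 ℕ.+ n)
    S = ∑ (suc n) (λ j → E n j * ifac (suc n ℕ.∸ j))
    ∣X∣≤ : ∣ X ∣ ≤ ifac (2 ℕ.+ n)
    ∣X∣≤ = begin
      ∣ X ∣                   ≡⟨ 0≤p⇒∣p∣≡p (*-nonNeg (r-nonNeg 0 (suc n)) (ifac-nonNeg (2 ℕ.+ n))) ⟩
      X                       ≤⟨ *-monoʳ (ifac (2 ℕ.+ n)) (ifac-nonNeg (2 ℕ.+ n)) (r≤1 ℕ.z≤n) ⟩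
      1ℚ * ifac (2 ℕ.+ n)     ≡⟨ *-identityˡ _ ⟩
      ifac (2 ℕ.+ n)          ∎
    ∑∣∣≡ : ∑ (suc n) (λ j → ∣ E n j * ifac (suc n ℕ.∸ j) ∣) ≡ ∑ (suc n) (λ j → ∣ E n j ∣ * ifac (suc n ℕ.∸ j))
    ∑∣∣≡ = ∑-cong (suc n) (λ j _ → trans (∣p*q∣≡∣p∣*∣q∣ (E n j) _) (cong (∣ E n j ∣ *_) (0≤p⇒∣p∣≡p (ifac-nonNeg (suc n ℕ.∸ j)))))

  -- For n = 0 it follows from σ ∈ [1/2, 1]; for n ≥ 1,
  --   d_n = σ_n σ_(n+1) |V_(n+1) − V_n| ≤ (4/5)² ((1/4) θ^n + (21/16) θ^n) = θ^n.
  d-step : ∀ n → Decays n → d n ≤ θ ^ n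
  d-step zero    h = ≤-trans (interval (σ≥½ 1) (σ≤1 1) (σ≥½ 0) (σ≤1 0)) (≤ᵇ⇒≤ _)
  d-step (suc m) h = begin
    d n                                                   ≡⟨ cong ∣_∣ (σ-diff n) ⟩
    ∣ σ n * σ (suc n) * (V n - V (suc n)) ∣               ≡⟨ ∣nonNeg*∣ (σ n * σ (suc n)) _ σσ-nonNeg ⟩
    σ n * σ (suc n) * ∣ V n - V (suc n) ∣                 ≡⟨ cong (σ n * σ (suc n) *_) (∣-∣-sym (V n) (V (suc n))) ⟩
    σ n * σ (suc n) * ∣ V (suc n) - V n ∣
      ≤⟨ *-mono σσ-nonNeg (0≤∣p∣ _) (*-mono (σ-nonNeg n) (σ-nonNeg (suc n)) (σ-suc≤4/5 m) (σ-suc≤4/5 (suc m))) (V-diff-bound n h) ⟩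
    (+ 4 / 5) * (+ 4 / 5) * (ifac (3 ℕ.+ m) + θ ^ n * W n)
      ≤⟨ *-monoˡ ((+ 4 / 5) * (+ 4 / 5)) (nonNegative⁻¹ _) (+-mono-≤ (ifac-θ-bound m) (*-monoˡ (θ ^ n) (θ^-nonNeg n) (W≤21/16 n))) ⟩
    (+ 4 / 5) * (+ 4 / 5) * ((+ 1 / 4) * θ ^ n + θ ^ n * (+ 21 / 16))
      ≡⟨ solve 1 (λ p → con (+ 4 / 5) :* con (+ 4 / 5) :* (con (+ 1 / 4) :* p :+ p :* con (+ 21 / 16)) := p) refl (θ ^ n) ⟩
    θ ^ n                                                 ∎
    where
    open ≤-Reasoning
    n = suc m
    σσ-nonNeg = *-nonNeg (σ-nonNeg n) (σ-nonNeg (suc n))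

  d≤θ^ : ∀ n → d n ≤ θ ^ n
  d≤θ^ = <-rec (λ n → d n ≤ θ ^ n) d-step

-- The ratio f_n/g_n: Cauchy property and numerical localisation.
module Convergence where

  open OrderedBell using (a; a-pos; g≡a; f-rec)
  open Rationals
  open Normalisation
  open RatioBounds
  open Contraction
  open import Data.Nat as ℕ using (ℕ; zero; suc)
  import Data.Nat.Properties as ℕP
  open import Data.Integer as ℤ using (+_; +[1+_]; -[1+_])
  open import Data.Rational
  open import Data.Rational.Properties
  open import Data.Rational.Solver using (module +-*-Solver)
  open import Data.Product using (_×_; _,_; proj₁; proj₂; ∃-syntax)
  open import Defs using (g; f; ratio)
  open import Relation.Binary.PropositionalEquality
  open +-*-Solver

  σ-tail : ∀ N k → ∣ σ (N ℕ.+ k) - σ N ∣ ≤ (+ 10 / 1) * (θ ^ N - θ ^ (N ℕ.+ k))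
  σ-tail N zero rewrite ℕP.+-identityʳ N =
    ≤-reflexive (trans (cong ∣_∣ (+-inverseʳ (σ N))) (sym (trans (cong ((+ 10 / 1) *_) (+-inverseʳ (θ ^ N))) (*-zeroʳ (+ 10 / 1)))))
  σ-tail N (suc k) rewrite ℕP.+-suc N k = begin
    ∣ σ (suc M) - σ N ∣                      ≤⟨ ∣-∣-triangle (σ (suc M)) (σ M) (σ N) ⟩
    d M + ∣ σ M - σ N ∣                      ≤⟨ +-mono-≤ (d≤θ^ M) (σ-tail N k) ⟩
    θ ^ M + (+ 10 / 1) * (θ ^ N - θ ^ M)
      ≡⟨ solve 2 (λ a b → a :+ con (+ 10 / 1) :* (b :- a) := con (+ 10 / 1) :* (b :- con (+ 9 / 10) :* a)) refl (θ ^ M) (θ ^ N) ⟩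
    (+ 10 / 1) * (θ ^ N - (+ 9 / 10) * θ ^ M) ≡⟨ cong (λ z → (+ 10 / 1) * (θ ^ N - z * θ ^ M)) θ-def ⟨
    (+ 10 / 1) * (θ ^ N - θ ^ suc M)         ∎
    where
    open ≤-Reasoning
    M = N ℕ.+ k

  σ-tail′ : ∀ N k → ∣ σ (N ℕ.+ k) - σ N ∣ ≤ (+ 10 / 1) * θ ^ N
  σ-tail′ N k = ≤-trans (σ-tail N k) (*-monoˡ (+ 10 / 1) (nonNegative⁻¹ _) θ^N-θ^M≤θ^N)
    where
    θ^N-θ^M≤θ^N : θ ^ N - θ ^ (N ℕ.+ k) ≤ θ ^ N
    θ^N-θ^M≤θ^N = subst (θ ^ N - θ ^ (N ℕ.+ k) ≤_) (solve 2 (λ a b → a :- b :+ b := a) refl (θ ^ N) (θ ^ (N ℕ.+ k)))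
                    (p≤p+q (θ ^ N - θ ^ (N ℕ.+ k)) (θ^-nonNeg (N ℕ.+ k)))

  σ-close : ∀ N m n → N ℕ.≤ m → N ℕ.≤ n → ∣ σ m - σ n ∣ ≤ (+ 20 / 1) * θ ^ N
  σ-close N m n N≤m N≤n = begin
    ∣ σ m - σ n ∣                            ≤⟨ ∣-∣-triangle (σ m) (σ N) (σ n) ⟩
    ∣ σ m - σ N ∣ + ∣ σ N - σ n ∣            ≡⟨ cong (_+_ ∣ σ m - σ N ∣) (∣-∣-sym (σ N) (σ n)) ⟩
    ∣ σ m - σ N ∣ + ∣ σ n - σ N ∣            ≤⟨ +-mono-≤ (from-N m N≤m) (from-N n N≤n) ⟩
    (+ 10 / 1) * θ ^ N + (+ 10 / 1) * θ ^ N  ≡⟨ solve 1 (λ t → con (+ 10 / 1) :* t :+ con (+ 10 / 1) :* t := con (+ 20 / 1) :* t) refl (θ ^ N) ⟩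
    (+ 20 / 1) * θ ^ N                       ∎
    where
    open ≤-Reasoning
    from-N : ∀ m → N ℕ.≤ m → ∣ σ m - σ N ∣ ≤ (+ 10 / 1) * θ ^ N
    from-N m N≤m = subst (λ z → ∣ σ z - σ N ∣ ≤ (+ 10 / 1) * θ ^ N) (ℕP.m+[n∸m]≡n N≤m) (σ-tail′ N (m ℕ.∸ N))

  θ^-harmonic : ∀ N → θ ^ N * ι (9 ℕ.+ N) ≤ + 9 / 1
  θ^-harmonic zero    = ≤-reflexive (trans (*-identityˡ _) (ι-def 9))
  θ^-harmonic (suc N) = begin
    θ * θ ^ N * ι (9 ℕ.+ suc N)            ≡⟨ cong (λ z → θ * θ ^ N * ι z) (ℕP.+-suc 9 N) ⟩
    θ * θ ^ N * ι (1 ℕ.+ (9 ℕ.+ N))        ≡⟨ cong (θ * θ ^ N *_) (trans (ι-+ 1 (9 ℕ.+ N)) (cong (_+ ι (9 ℕ.+ N)) ι-1)) ⟩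
    θ * θ ^ N * (1ℚ + ι (9 ℕ.+ N))         ≡⟨ solve 3 (λ t p i → t :* p :* (con 1ℚ :+ i) := t :* (p :* i) :+ t :* p) refl θ (θ ^ N) (ι (9 ℕ.+ N)) ⟩
    θ * (θ ^ N * ι (9 ℕ.+ N)) + θ * θ ^ N  ≤⟨ +-mono-≤ (*-monoˡ θ θ-nonNeg (θ^-harmonic N)) (*-monoˡ θ θ-nonNeg (θ^≤1 N)) ⟩
    θ * (+ 9 / 1) + θ * 1ℚ                 ≡⟨ cong (λ z → z * (+ 9 / 1) + z * 1ℚ) θ-def ⟩
    (+ 9 / 10) * (+ 9 / 1) + (+ 9 / 10) * 1ℚ ≤⟨ ≤ᵇ⇒≤ _ ⟩
    + 9 / 1                                ∎
    where open ≤-Reasoning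

  θ^≤9/[N+1] : ∀ N → θ ^ N ≤ (+ 9 / 1) * 1/ ι (suc N)
  θ^≤9/[N+1] N = begin
    θ ^ N                                     ≡⟨ *-identityʳ _ ⟨
    θ ^ N * 1ℚ                                ≡⟨ cong (θ ^ N *_) (*-inverseʳ (ι (9 ℕ.+ N))) ⟨
    θ ^ N * (ι (9 ℕ.+ N) * 1/ ι (9 ℕ.+ N))    ≡⟨ *-assoc (θ ^ N) _ _ ⟨
    θ ^ N * ι (9 ℕ.+ N) * 1/ ι (9 ℕ.+ N)      ≤⟨ *-monoʳ (1/ ι (9 ℕ.+ N)) (1/-nonNeg _ (ι-pos (9 ℕ.+ N))) (θ^-harmonic N) ⟩
    (+ 9 / 1) * 1/ ι (9 ℕ.+ N)                ≤⟨ *-monoˡ (+ 9 / 1) (nonNegative⁻¹ _) (1/ι-antimono (ℕP.m≤n+m N 8)) ⟩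
    (+ 9 / 1) * 1/ ι (suc N)                  ∎
    where open ≤-Reasoning

  instance
    ιa-nonZero : ∀ {n} → NonZero (ι (a n))
    ιa-nonZero {n} = pos⇒nz (ι-pos (a n) {{ℕ.>-nonZero (a-pos n)}})

  σ-formula : ∀ n → σ n ≡ ι (suc n) * ι (a n) * 1/ ι (a (suc n))
  σ-formula n = begin
    c n * 1/ c (suc n)
      ≡⟨ cong₂ _*_ (c-def n) (1/-unique (c (suc n)) _ inverse) ⟩
    ι (a n) * ifac n * (ι (suc n ℕ.!) * 1/ ι (a (suc n)))
      ≡⟨ cong (λ z → ι (a n) * ifac n * (z * 1/ ι (a (suc n)))) (ι-* (suc n) (n ℕ.!)) ⟩
    ι (a n) * ifac n * (ι (suc n) * ι (n ℕ.!) * 1/ ι (a (suc n)))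
      ≡⟨ solve 5 (λ x y z w v → x :* y :* (z :* w :* v) := z :* x :* v :* (w :* y)) refl (ι (a n)) (ifac n) (ι (suc n)) (ι (n ℕ.!)) (1/ ι (a (suc n))) ⟩
    ι (suc n) * ι (a n) * 1/ ι (a (suc n)) * (ι (n ℕ.!) * ifac n)
      ≡⟨ cong (ι (suc n) * ι (a n) * 1/ ι (a (suc n)) *_) (ifac-inv n) ⟩
    ι (suc n) * ι (a n) * 1/ ι (a (suc n)) * 1ℚ
      ≡⟨ *-identityʳ _ ⟩
    ι (suc n) * ι (a n) * 1/ ι (a (suc n)) ∎
    where
    open ≡-Reasoning
    inverse : c (suc n) * (ι (suc n ℕ.!) * 1/ ι (a (suc n))) ≡ 1ℚ
    inverse = begin
      c (suc n) * (ι (suc n ℕ.!) * 1/ ι (a (suc n)))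
        ≡⟨ cong (_* (ι (suc n ℕ.!) * 1/ ι (a (suc n)))) (c-def (suc n)) ⟩
      ι (a (suc n)) * ifac (suc n) * (ι (suc n ℕ.!) * 1/ ι (a (suc n)))
        ≡⟨ solve 4 (λ x y z w → x :* y :* (z :* w) := (x :* w) :* (z :* y)) refl (ι (a (suc n))) (ifac (suc n)) (ι (suc n ℕ.!)) (1/ ι (a (suc n))) ⟩
      (ι (a (suc n)) * 1/ ι (a (suc n))) * (ι (suc n ℕ.!) * ifac (suc n))
        ≡⟨ cong₂ _*_ (*-inverseʳ (ι (a (suc n)))) (ifac-inv (suc n)) ⟩
      1ℚ * 1ℚ ≡⟨ *-identityˡ 1ℚ ⟩
      1ℚ ∎

  y : ℕ → ℚ
  y p = σ (1 ℕ.+ p) * σ (2 ℕ.+ p) * 1/ ι (3 ℕ.+ p)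

  y-formula : ∀ p → y p ≡ ι (2 ℕ.+ p) * ι (a (1 ℕ.+ p)) * 1/ ι (a (3 ℕ.+ p))
  y-formula p = begin
    σ (1 ℕ.+ p) * σ (2 ℕ.+ p) * 1/ ι (3 ℕ.+ p)
      ≡⟨ cong₂ (λ u v → u * v * 1/ ι (3 ℕ.+ p)) (σ-formula (1 ℕ.+ p)) (σ-formula (2 ℕ.+ p)) ⟩
    ι (2 ℕ.+ p) * A₁ * 1/ A₂ * (ι (3 ℕ.+ p) * A₂ * 1/ A₃) * 1/ ι (3 ℕ.+ p)
      ≡⟨ solve 7 (λ i2 a1 ia2 i3 a2 ia3 ii3 → i2 :* a1 :* ia2 :* (i3 :* a2 :* ia3) :* ii3 := i2 :* a1 :* ia3 :* (a2 :* ia2) :* (i3 :* ii3))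
           refl (ι (2 ℕ.+ p)) A₁ (1/ A₂) (ι (3 ℕ.+ p)) A₂ (1/ A₃) (1/ ι (3 ℕ.+ p)) ⟩
    ι (2 ℕ.+ p) * A₁ * 1/ A₃ * (A₂ * 1/ A₂) * (ι (3 ℕ.+ p) * 1/ ι (3 ℕ.+ p))
      ≡⟨ cong₂ (λ u v → ι (2 ℕ.+ p) * A₁ * 1/ A₃ * u * v) (*-inverseʳ A₂) (*-inverseʳ (ι (3 ℕ.+ p))) ⟩
    ι (2 ℕ.+ p) * A₁ * 1/ A₃ * 1ℚ * 1ℚ
      ≡⟨ trans (*-identityʳ _) (*-identityʳ _) ⟩
    ι (2 ℕ.+ p) * A₁ * 1/ A₃ ∎
    where
    open ≡-Reasoning
    A₁ = ι (a (1 ℕ.+ p))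
    A₂ = ι (a (2 ℕ.+ p))
    A₃ = ι (a (3 ℕ.+ p))

  y-nonNeg : ∀ p → 0ℚ ≤ y p
  y-nonNeg p = *-nonNeg (*-nonNeg (σ-nonNeg _) (σ-nonNeg _)) (1/-nonNeg _ (ι-pos (3 ℕ.+ p)))

  y≤ : ∀ p → y p ≤ 1/ ι (3 ℕ.+ p)
  y≤ p = begin
    σ (1 ℕ.+ p) * σ (2 ℕ.+ p) * 1/ ι (3 ℕ.+ p)  ≤⟨ *-monoʳ (1/ ι (3 ℕ.+ p)) (1/-nonNeg _ (ι-pos (3 ℕ.+ p))) (*-mono (σ-nonNeg _) (σ-nonNeg _) (σ≤1 _) (σ≤1 _)) ⟩
    1ℚ * 1ℚ * 1/ ι (3 ℕ.+ p)                    ≡⟨ cong (_* 1/ ι (3 ℕ.+ p)) (*-identityˡ 1ℚ) ⟩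
    1ℚ * 1/ ι (3 ℕ.+ p)                         ≡⟨ *-identityˡ _ ⟩
    1/ ι (3 ℕ.+ p)                              ∎
    where open ≤-Reasoning

  ratio-frac : ∀ n k .{{_ : ℕ.NonZero k}} → g n ≡ k → ratio n ≡ ι (f n) * (1/ ι k) {{pos⇒nz (ι-pos k)}}
  ratio-frac n (suc d) eq = trans (unfold eq) (frac-ι (f n) d)
    where
    unfold : g n ≡ suc d → ratio n ≡ (+ f n) / suc d
    unfold eq with g n | eq
    ... | .(suc d) | refl = refl

  ι-f-rec : ∀ p → ι (f (4 ℕ.+ p)) ≡ (+ 2 / 1) * (ι (3 ℕ.+ p) * ι (a (2 ℕ.+ p))) - (+ 2 / 1) * (ι (2 ℕ.+ p) * ι (a (1 ℕ.+ p)))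
  ι-f-rec p = begin
    F                 ≡⟨ solve 2 (λ x y → x := x :+ y :- y) refl F Y ⟩
    F + Y - Y         ≡⟨ cong (_- Y) (trans (sym (ι-+ (f (4 ℕ.+ p)) _)) (cong ι (f-rec p))) ⟩
    Z - Y             ≡⟨ cong₂ _-_ (twice (3 ℕ.+ p) (a (2 ℕ.+ p))) (twice (2 ℕ.+ p) (a (1 ℕ.+ p))) ⟩
    (+ 2 / 1) * (ι (3 ℕ.+ p) * ι (a (2 ℕ.+ p))) - (+ 2 / 1) * (ι (2 ℕ.+ p) * ι (a (1 ℕ.+ p))) ∎
    where
    open ≡-Reasoning
    F = ι (f (4 ℕ.+ p))
    Y = ι ((2 ℕ.+ p) ℕ.* (2 ℕ.* a (1 ℕ.+ p)))
    Z = ι ((3 ℕ.+ p) ℕ.* (2 ℕ.* a (2 ℕ.+ p)))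
    twice : ∀ k q → ι (k ℕ.* (2 ℕ.* q)) ≡ (+ 2 / 1) * (ι k * ι q)
    twice k q = begin
      ι (k ℕ.* (2 ℕ.* q))     ≡⟨ trans (ι-* k (2 ℕ.* q)) (cong (ι k *_) (ι-* 2 q)) ⟩
      ι k * (ι 2 * ι q)       ≡⟨ cong (λ z → ι k * (z * ι q)) (ι-def 2) ⟩
      ι k * ((+ 2 / 1) * ι q) ≡⟨ solve 2 (λ x z → x :* (con (+ 2 / 1) :* z) := con (+ 2 / 1) :* (x :* z)) refl (ι k) (ι q) ⟩
      (+ 2 / 1) * (ι k * ι q) ∎

  ratio-formula : ∀ p → ratio (4 ℕ.+ p) ≡ (+ 2 / 1) * σ (2 ℕ.+ p) - (+ 2 / 1) * y p
  ratio-formula p = begin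
    ratio (4 ℕ.+ p)
      ≡⟨ ratio-frac (4 ℕ.+ p) (a (3 ℕ.+ p)) {{ℕ.>-nonZero (a-pos (3 ℕ.+ p))}} (g≡a (3 ℕ.+ p)) ⟩
    ι (f (4 ℕ.+ p)) * 1/ A₃
      ≡⟨ cong (_* 1/ A₃) (ι-f-rec p) ⟩
    ((+ 2 / 1) * (ι (3 ℕ.+ p) * A₂) - (+ 2 / 1) * (ι (2 ℕ.+ p) * A₁)) * 1/ A₃
      ≡⟨ solve 5 (λ i3 a2 i2 a1 ia → (con (+ 2 / 1) :* (i3 :* a2) :- con (+ 2 / 1) :* (i2 :* a1)) :* ia := con (+ 2 / 1) :* (i3 :* a2 :* ia) :- con (+ 2 / 1) :* (i2 :* a1 :* ia)) refl (ι (3 ℕ.+ p)) A₂ (ι (2 ℕ.+ p)) A₁ (1/ A₃) ⟩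
    (+ 2 / 1) * (ι (3 ℕ.+ p) * A₂ * 1/ A₃) - (+ 2 / 1) * (ι (2 ℕ.+ p) * A₁ * 1/ A₃)
      ≡⟨ cong₂ (λ u v → (+ 2 / 1) * u - (+ 2 / 1) * v) (σ-formula (2 ℕ.+ p)) (y-formula p) ⟨
    (+ 2 / 1) * σ (2 ℕ.+ p) - (+ 2 / 1) * y p ∎
    where
    open ≡-Reasoning
    A₁ = ι (a (1 ℕ.+ p))
    A₂ = ι (a (2 ℕ.+ p))
    A₃ = ι (a (3 ℕ.+ p))

  -- Both terms of the formula are controlled from index N on:
  --   |ratio m − ratio n| ≤ 2·20·9/(N+1) + 2/(N+1) = 362/(N+1)   for m, n ≥ N+4.
  ratio-modulus : ∀ N p q → N ℕ.≤ p → N ℕ.≤ q →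
                  ∣ ratio (4 ℕ.+ p) - ratio (4 ℕ.+ q) ∣ ≤ (+ 362 / 1) * 1/ ι (suc N)
  ratio-modulus N p q N≤p N≤q = begin
    ∣ ratio (4 ℕ.+ p) - ratio (4 ℕ.+ q) ∣
      ≡⟨ cong₂ (λ u v → ∣ u - v ∣) (ratio-formula p) (ratio-formula q) ⟩
    ∣ (two * σ (2 ℕ.+ p) - two * y p) - (two * σ (2 ℕ.+ q) - two * y q) ∣
      ≡⟨ cong ∣_∣ (solve 4 (λ a b c e → (con two :* a :- con two :* b) :- (con two :* c :- con two :* e) := con two :* (a :- c) :+ con two :* (e :- b)) refl (σ (2 ℕ.+ p)) (y p) (σ (2 ℕ.+ q)) (y q)) ⟩
    ∣ two * (σ (2 ℕ.+ p) - σ (2 ℕ.+ q)) + two * (y q - y p) ∣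
      ≤⟨ ∣p+q∣≤∣p∣+∣q∣ (two * (σ (2 ℕ.+ p) - σ (2 ℕ.+ q))) (two * (y q - y p)) ⟩
    ∣ two * (σ (2 ℕ.+ p) - σ (2 ℕ.+ q)) ∣ + ∣ two * (y q - y p) ∣
      ≡⟨ cong₂ _+_ (∣nonNeg*∣ two (σ (2 ℕ.+ p) - σ (2 ℕ.+ q)) (nonNegative⁻¹ two)) (∣nonNeg*∣ two (y q - y p) (nonNegative⁻¹ two)) ⟩
    two * ∣ σ (2 ℕ.+ p) - σ (2 ℕ.+ q) ∣ + two * ∣ y q - y p ∣
      ≤⟨ +-mono-≤ (*-monoˡ two (nonNegative⁻¹ two) σ-part) (*-monoˡ two (nonNegative⁻¹ two) y-part) ⟩
    two * ((+ 20 / 1) * ((+ 9 / 1) * I)) + two * (I - 0ℚ)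
      ≡⟨ solve 1 (λ i → con two :* (con (+ 20 / 1) :* (con (+ 9 / 1) :* i)) :+ con two :* (i :- con 0ℚ) := con (+ 362 / 1) :* i) refl I ⟩
    (+ 362 / 1) * I ∎
    where
    open ≤-Reasoning
    two = + 2 / 1
    I = 1/ ι (suc N)
    σ-part : ∣ σ (2 ℕ.+ p) - σ (2 ℕ.+ q) ∣ ≤ (+ 20 / 1) * ((+ 9 / 1) * I)
    σ-part = ≤-trans (σ-close N (2 ℕ.+ p) (2 ℕ.+ q) (ℕP.≤-trans N≤p (ℕP.m≤n+m p 2)) (ℕP.≤-trans N≤q (ℕP.m≤n+m q 2)))
                     (*-monoˡ (+ 20 / 1) (nonNegative⁻¹ _) (θ^≤9/[N+1] N))
    y≤I : ∀ r → N ℕ.≤ r → y r ≤ I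
    y≤I r N≤r = ≤-trans (y≤ r) (1/ι-antimono (ℕP.≤-trans N≤r (ℕP.m≤n+m r 2)))
    y-part : ∣ y q - y p ∣ ≤ I - 0ℚ
    y-part = interval (y-nonNeg q) (y≤I q N≤q) (y-nonNeg p) (y≤I p N≤p)

  archimedean : ∀ K (ε : ℚ) → 0ℚ < ε → ∃[ N ] (ι K * 1/ ι (suc N) < ε)
  archimedean K ε@(mkℚ +[1+ u ] v _) _ = N , subst (ι K * 1/ ι (suc N) <_) (sym ε≡) K/[N+1]<ε
    where
    N = K ℕ.* suc v
    ε≡ : ε ≡ ι (suc u) * 1/ ι (suc v)
    ε≡ = trans (sym (fromℚᵘ-toℚᵘ ε)) (frac-ι (suc u) v)
    cross-ℕ : K ℕ.* suc v ℕ.< suc u ℕ.* suc N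
    cross-ℕ = ℕP.<-≤-trans (ℕP.n<1+n N) (ℕP.m≤n*m (suc N) (suc u))
    K/[N+1]<ε : ι K * 1/ ι (suc N) < ι (suc u) * 1/ ι (suc v)
    K/[N+1]<ε = <-cross (ι K) (ι (suc u)) (ι (suc N)) (ι (suc v)) (ι-pos (suc N)) (ι-pos (suc v))
      (subst₂ _<_ (ι-* K (suc v)) (ι-* (suc u) (suc N)) (ι-mono-< cross-ℕ))
  archimedean K (mkℚ (+ 0)    v _) (*<* (ℤ.+<+ ()))
  archimedean K (mkℚ -[1+ u ] v _) (*<* ())

  ratio-cauchy : (ε : ℚ) → 0ℚ < ε → ∃[ N ] ((m n : ℕ) → N ℕ.≤ m → N ℕ.≤ n → ∣ ratio m - ratio n ∣ < ε)
  ratio-cauchy ε 0<ε with archimedean 362 ε 0<ε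
  ... | N , small = 4 ℕ.+ N , λ m n N+4≤m N+4≤n →
    ≤-<-trans (shifted m n N+4≤m N+4≤n) (subst (λ z → z * 1/ ι (suc N) < ε) (ι-def 362) small)
    where
    shifted : ∀ m n → 4 ℕ.+ N ℕ.≤ m → 4 ℕ.+ N ℕ.≤ n → ∣ ratio m - ratio n ∣ ≤ (+ 362 / 1) * 1/ ι (suc N)
    shifted m n hm hn = subst₂ (λ z w → ∣ ratio z - ratio w ∣ ≤ (+ 362 / 1) * 1/ ι (suc N))
      (ℕP.m+[n∸m]≡n (ℕP.≤-trans (ℕP.m≤m+n 4 N) hm)) (ℕP.m+[n∸m]≡n (ℕP.≤-trans (ℕP.m≤m+n 4 N) hn))
      (ratio-modulus N (m ℕ.∸ 4) (n ℕ.∸ 4) (ℕP.∸-monoˡ-≤ 4 hm) (ℕP.∸-monoˡ-≤ 4 hn))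

  ℕ-frac-≤ : ∀ x y X Y .{{_ : ℕ.NonZero X}} .{{_ : ℕ.NonZero Y}} → x ℕ.* Y ℕ.≤ y ℕ.* X →
             ι x * (1/ ι X) {{pos⇒nz (ι-pos X)}} ≤ ι y * (1/ ι Y) {{pos⇒nz (ι-pos Y)}}
  ℕ-frac-≤ x y X Y h = ≤-cross (ι x) (ι y) (ι X) (ι Y) {{pos⇒nz (ι-pos X)}} {{pos⇒nz (ι-pos Y)}} (ι-pos X) (ι-pos Y)
    (subst₂ _≤_ (ι-* x Y) (ι-* y X) (ι-mono h))

  opaque
    unfolding a

    a-ratio-lower : 6931 ℕ.* a 133 ℕ.≤ (133 ℕ.* a 132) ℕ.* 10000
    a-ratio-lower = ℕP.≤ᵇ⇒≤ (6931 ℕ.* a 133) ((133 ℕ.* a 132) ℕ.* 10000) _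

    a-ratio-upper : (133 ℕ.* a 132) ℕ.* 10000 ℕ.≤ 6932 ℕ.* a 133
    a-ratio-upper = ℕP.≤ᵇ⇒≤ ((133 ℕ.* a 132) ℕ.* 10000) (6932 ℕ.* a 133) _

  σ132-as-frac : σ 132 ≡ ι (133 ℕ.* a 132) * 1/ ι (a 133)
  σ132-as-frac = trans (σ-formula 132) (cong (_* 1/ ι (a 133)) (sym (ι-* 133 (a 132))))

  σ132-lower : + 6931 / 10000 ≤ σ 132
  σ132-lower = subst₂ _≤_ (sym (frac-ι 6931 9999)) (sym σ132-as-frac)
    (ℕ-frac-≤ 6931 (133 ℕ.* a 132) 10000 (a 133) {{_}} {{ℕ.>-nonZero (a-pos 133)}} a-ratio-lower)

  σ132-upper : σ 132 ≤ + 6932 / 10000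
  σ132-upper = subst₂ _≤_ (sym σ132-as-frac) (sym (frac-ι 6932 9999))
    (ℕ-frac-≤ (133 ℕ.* a 132) 6932 (a 133) 10000 {{ℕ.>-nonZero (a-pos 133)}} {{_}} a-ratio-upper)

  opaque
    unfolding θ ι

    tail132 : (+ 10 / 1) * θ ^ 132 ≤ + 1 / 10000
    tail132 = ≤ᵇ⇒≤ _

    1/133≤ : 1/ ι 133 ≤ + 1 / 133
    1/133≤ = ≤ᵇ⇒≤ _

  σ-near : ∀ n → 132 ℕ.≤ n → + 6930 / 10000 ≤ σ n × σ n ≤ + 6933 / 10000
  σ-near n 132≤n = lower , upper
    where
    close : σ n - σ 132 ≤ + 1 / 10000 × - (σ n - σ 132) ≤ + 1 / 10000
    close = ∣∣-≤⁻ (≤-trans (subst (λ z → ∣ σ z - σ 132 ∣ ≤ (+ 10 / 1) * θ ^ 132) (ℕP.m+[n∸m]≡n 132≤n) (σ-tail′ 132 (n ℕ.∸ 132))) tail132)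
    upper : σ n ≤ + 6933 / 10000
    upper = begin
      σ n                           ≡⟨ solve 2 (λ s t → s := t :+ (s :- t)) refl (σ n) (σ 132) ⟩
      σ 132 + (σ n - σ 132)         ≤⟨ +-mono-≤ σ132-upper (proj₁ close) ⟩
      + 6932 / 10000 + + 1 / 10000  ≤⟨ ≤ᵇ⇒≤ _ ⟩
      + 6933 / 10000                ∎
      where open ≤-Reasoning
    lower : + 6930 / 10000 ≤ σ n
    lower = begin
      + 6930 / 10000                    ≤⟨ ≤ᵇ⇒≤ _ ⟩
      + 6931 / 10000 - + 1 / 10000      ≤⟨ +-mono-≤ σ132-lower (neg-antimono-≤ (proj₂ close)) ⟩
      σ 132 - - (σ n - σ 132)           ≡⟨ solve 2 (λ s t → t :- (:- (s :- t)) := s) refl (σ n) (σ 132) ⟩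
      σ n                               ∎
      where open ≤-Reasoning

  ratio-near : ∃[ N ] ((n : ℕ) → N ℕ.≤ n → ∣ ratio n - (+ 138 / 100) ∣ ≤ (+ 1 / 100))
  ratio-near = 134 , λ n 134≤n → subst (λ z → ∣ ratio z - (+ 138 / 100) ∣ ≤ (+ 1 / 100))
    (ℕP.m+[n∸m]≡n (ℕP.≤-trans (ℕP.m≤m+n 4 130) 134≤n)) (shifted (n ℕ.∸ 4) (ℕP.∸-monoˡ-≤ 4 134≤n))
    where
    shifted : ∀ p → 130 ℕ.≤ p → ∣ ratio (4 ℕ.+ p) - (+ 138 / 100) ∣ ≤ (+ 1 / 100)
    shifted p 130≤p = ∣∣-≤ above below
      where
      open ≤-Reasoning
      two = + 2 / 1
      s = σ (2 ℕ.+ p)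
      s-bounds = σ-near (2 ℕ.+ p) (ℕ.s≤s (ℕ.s≤s 130≤p))
      y≤1/133 : y p ≤ + 1 / 133
      y≤1/133 = ≤-trans (y≤ p) (≤-trans (1/ι-antimono (ℕ.s≤s (ℕ.s≤s 130≤p))) 1/133≤)
      above : ratio (4 ℕ.+ p) - (+ 138 / 100) ≤ (+ 1 / 100)
      above = begin
        ratio (4 ℕ.+ p) - (+ 138 / 100)            ≡⟨ cong (_- (+ 138 / 100)) (ratio-formula p) ⟩
        two * s - two * y p - (+ 138 / 100)
          ≤⟨ +-monoˡ-≤ (- (+ 138 / 100)) (+-mono-≤ (*-monoˡ two (nonNegative⁻¹ two) (proj₂ s-bounds))
                                                    (neg-antimono-≤ (*-monoˡ two (nonNegative⁻¹ two) (y-nonNeg p)))) ⟩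
        two * (+ 6933 / 10000) - two * 0ℚ - (+ 138 / 100) ≤⟨ ≤ᵇ⇒≤ _ ⟩
        + 1 / 100                                  ∎
      below : - (ratio (4 ℕ.+ p) - (+ 138 / 100)) ≤ (+ 1 / 100)
      below = begin
        - (ratio (4 ℕ.+ p) - (+ 138 / 100))        ≡⟨ cong (λ z → - (z - (+ 138 / 100))) (ratio-formula p) ⟩
        - (two * s - two * y p - (+ 138 / 100))
          ≡⟨ solve 2 (λ s y → :- (con two :* s :- con two :* y :- con (+ 138 / 100)) := con (+ 138 / 100) :- con two :* s :+ con two :* y) refl s (y p) ⟩
        (+ 138 / 100) - two * s + two * y p
          ≤⟨ +-mono-≤ (+-monoʳ-≤ (+ 138 / 100) (neg-antimono-≤ (*-monoˡ two (nonNegative⁻¹ two) (proj₁ s-bounds))))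
                      (*-monoˡ two (nonNegative⁻¹ two) y≤1/133) ⟩
        (+ 138 / 100) - two * (+ 6930 / 10000) + two * (+ 1 / 133) ≤⟨ ≤ᵇ⇒≤ _ ⟩
        + 1 / 100                                  ∎

open Convergence using (ratio-cauchy; ratio-near)
open import Defs
open import Data.Nat using (ℕ)
open import Data.Product using (_×_; ∃-syntax; _,_)
open import Data.Integer using (+_)
open import Data.Rational using (ℚ; 0ℚ; _/_; _-_; ∣_∣; _<_; _≤_)
import Data.Nat as ℕ

lemma2 : ((ε : ℚ) → 0ℚ < ε →
              ∃[ N ] ((m n : ℕ) → N ℕ.≤ m → N ℕ.≤ n → ∣ ratio m - ratio n ∣ < ε))
           × (∃[ N ] ((n : ℕ) → N ℕ.≤ n → ∣ ratio n - (+ 138 / 100) ∣ ≤ (+ 1 / 100)))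
lemma2 = ratio-cauchy , ratio-near
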